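{- Let $q=p^e$ with $p$ prime, $t\ge1$, $n\ge 2$, $d\ge 2$, and let $\boldsymbol{\sigma}=(\sigma_0,\ldots,\sigma_{d-1})$ with each $\sigma_i\in\mathrm{Gal}(\mathbb{F}_{q^t}|\mathbb{F}_q)$, $\sigma_i:x\mapsto x^{q^{h_i}}$, $0\le h_i<t$, such that $\sum_{i=0}^{d-1}q^{h_i}<q^t$. Let $P_0,\ldots,P_{d+1}$ be $d+2$ distinct points of $\mathrm{PG}(n-1,q^t)$ whose images under $\nu_{d,\boldsymbol{\sigma}}:\langle v\rangle\mapsto\langle v^{\sigma_0}\otimes\cdots\otimes v^{\sigma_{d-1}}\rangle$ are linearly dependent. Then the $P_i$ lie on a line $L=\langle a,b\rangle$ of $\mathrm{PG}(n-1,q^t)$; writing $P_i=\langle \alpha_i a+\beta_i b\rangle$ and $u_i=(\alpha_i,\beta_i)\in\mathbb{F}_{q^t}^2$, the $(d-1)$-dimensional subspaces $S(u_0),\ldots,S(u_{d+1})$ of the normal rational scroll $S_{1,1,\ldots,1}\subset\mathrm{PG}(2d-1,q^t)$ (whose Grassmann images correspond to the points $\nu_{d,\boldsymbol{\sigma}}(P_i)$) have the property that every line of $\mathrm{PG}(2d-1,q^t)$ meeting three of them meets all of them.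
   Context: For a vector $v$ and a field automorphism $\sigma$, $v^\sigma$ is obtained by applying $\sigma$ to each coordinate. Write $\mathbb{F}_{q^t}^{2d}=\bigoplus_{k=0}^{d-1}W_k$ with $W_k\cong\mathbb{F}_{q^t}^2$ the $k$-th block of two coordinates, and let $\iota_k:\mathbb{F}_{q^t}^2\to W_k$ be the corresponding embedding. For $u\in\mathbb{F}_{q^t}^2\setminus\{0\}$ let $S(u)=\langle \iota_0(u^{\sigma_0}),\iota_1(u^{\sigma_1}),\ldots,\iota_{d-1}(u^{\sigma_{d-1}})\rangle$, a $(d-1)$-dimensional projective subspace of $\mathrm{PG}(2d-1,q^t)$; the normal rational scroll $S_{1,\ldots,1}$ is the family $\{S(u)\}$. The Grassmann embedding sends $S(u)$ to $\langle \iota_0(u^{\sigma_0})\wedge\cdots\wedge\iota_{d-1}(u^{\sigma_{d-1}})\rangle$, which is identified with $\langle u^{\sigma_0}\otimes\cdots\otimes u^{\sigma_{d-1}}\rangle$. -}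

module Defs where

open import Level using (Level)
open import Data.Nat as ℕ using (ℕ; zero; suc; _<_; _≤_)
open import Data.Fin using (Fin; zero; suc; _≟_)
open import Data.Product using (Σ; _×_; _,_; ∃)
open import Relation.Nullary using (¬_; yes; no)
open import Relation.Binary.PropositionalEquality using (_≡_)
open import Algebra.Bundles using (CommutativeRing)

∑ℕ : (m : ℕ) → (Fin m → ℕ) → ℕ
∑ℕ zero    f = 0
∑ℕ (suc m) f = f zero ℕ.+ ∑ℕ m (λ i → f (suc i))

module FieldDefs {c ℓ : Level} (R : CommutativeRing c ℓ) where
  open CommutativeRing R hiding (zero)

  pow : Carrier → ℕ → Carrier
  pow x zero    = 1#
  pow x (suc k) = x * pow x k

  ∑ : (m : ℕ) → (Fin m → Carrier) → Carrier
  ∑ zero    f = 0#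
  ∑ (suc m) f = f zero + ∑ m (λ i → f (suc i))

  ∏ : (m : ℕ) → (Fin m → Carrier) → Carrier
  ∏ zero    f = 1#
  ∏ (suc m) f = f zero * ∏ m (λ i → f (suc i))

  IsField : Set _
  IsField = (¬ (1# ≈ 0#)) × (∀ x → ¬ (x ≈ 0#) → ∃ λ y → x * y ≈ 1#)

  IsFiniteFieldOfOrder : ℕ → Set _
  IsFiniteFieldOfOrder N =
    IsField ×
    (Σ (Fin N → Carrier) λ enum →
       (∀ i j → enum i ≈ enum j → i ≡ j) × (∀ x → ∃ λ i → enum i ≈ x))

  frob : ℕ → ℕ → Carrier → Carrier
  frob q h x = pow x (q ℕ.^ h)

  Vect : ℕ → Set c
  Vect m = Fin m → Carrier

  IsZero : ∀ {m} → Vect m → Set _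
  IsZero v = ∀ j → v j ≈ 0#

  NonZero : ∀ {m} → Vect m → Set _
  NonZero v = ¬ IsZero v

  SamePoint : ∀ {m} → Vect m → Vect m → Set _
  SamePoint v w = ∃ λ k → ∀ j → w j ≈ k * v j

  -- F^{2d} = ⊕_{k<d} W_k, with W_k ≅ F^2 ; a vector is indexed by (block k, coordinate j)
  Vect2d : ℕ → Set c
  Vect2d d = Fin d → Fin 2 → Carrier

  Indep₂ : ∀ {m} → Vect m → Vect m → Set _
  Indep₂ x y = ∀ a b → (∀ j → a * x j + b * y j ≈ 0#) → (a ≈ 0#) × (b ≈ 0#)

  Indep₂-2d : ∀ {d} → Vect2d d → Vect2d d → Set _
  Indep₂-2d x y = ∀ a b → (∀ k j → a * x k j + b * y k j ≈ 0#) → (a ≈ 0#) × (b ≈ 0#)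

  -- Veronese-type image: v^{σ_0} ⊗ ⋯ ⊗ v^{σ_{d-1}}, a vector indexed by (Fin d → Fin n)
  tensorImage : ∀ {n} (q d : ℕ) (h : Fin d → ℕ) → Vect n → (Fin d → Fin n) → Carrier
  tensorImage q d h v J = ∏ d (λ i → frob q (h i) (v (J i)))

  LinDepTensors : ∀ {n} (d K : ℕ) → (Fin K → (Fin d → Fin n) → Carrier) → Set _
  LinDepTensors d K T =
    Σ (Fin K → Carrier) λ coeff →
      (¬ (∀ k → coeff k ≈ 0#)) × (∀ J → ∑ K (λ k → coeff k * T k J) ≈ 0#)


  ι : ∀ {d} → Fin d → Vect 2 → Vect2d d
  ι k w k' j with k ≟ k'
  ... | yes _ = w j
  ... | no  _ = 0#

  -- the point ⟨ λ x + μ y ⟩ of the line ⟨x,y⟩ lies in S(u) = ⟨ι_0(u^{σ_0}),…,ι_{d-1}(u^{σ_{d-1}})⟩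
  LineMeetsS : (q d : ℕ) (h : Fin d → ℕ) → Vect2d d → Vect2d d → Vect 2 → Set _
  LineMeetsS q d h x y u =
    Σ Carrier λ a → Σ Carrier λ b → Σ (Fin d → Carrier) λ c →
      (¬ ((a ≈ 0#) × (b ≈ 0#))) ×
      (∀ k' j → a * x k' j + b * y k' j
                 ≈ ∑ d (λ k → c k * ι k (λ j' → frob q (h k) (u j')) k' j))

  ThreeImpliesAll : (q d K : ℕ) (h : Fin d → ℕ) → (Fin K → Vect 2) → Set _
  ThreeImpliesAll q d K h u =
    ∀ (x y : Vect2d d) → Indep₂-2d x y →
    ∀ (i j k : Fin K) → ¬ (i ≡ j) → ¬ (i ≡ k) → ¬ (j ≡ k) →
    LineMeetsS q d h x y (u i) → LineMeetsS q d h x y (u j) → LineMeetsS q d h x y (u k) →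
    ∀ l → LineMeetsS q d h x y (u l)

  pair2 : Carrier → Carrier → Vect 2
  pair2 α β zero    = α
  pair2 α β (suc _) = β

{-# OPTIONS --safe #-}
module Submission where

-- The Frobenius maps σᵢ are injective ring endomorphisms (the field has characteristic p),
-- so pairing a dependence ∑ c_k ν(P_k) = 0 with functionals γ₀, …, γ_{d-1} gives
-- ∑_k c_k ∏ᵢ σᵢ⟨γᵢ, P_k⟩ = 0, and d functionals suffice to kill all but one or two of the
-- d + 2 points. Isolating a point P_r with c_r ≠ 0 puts it on the line through any two other
-- points, so all P_k are collinear. In coordinates u_k = (α_k, β_k) on that line, with
-- D(x, y) = det(u_x, u_y), isolating one or two points shows that every c_k ≠ 0 and that
-- σ_β(D_ki D_lj) σ_β′(D_kj D_li) is symmetric in the slots β, β′. If a line meets S(u_i),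
-- S(u_j), S(u_k) at parameters W_i, W_j, W_k, so that Δ W_k = μ W_i + ν W_j by Cramer's rule,
-- then this symmetry makes every block of the point σ₀(D_ki D_lj) μ W_i + σ₀(D_kj D_li) ν W_j
-- proportional to σ_β(u_l), i.e. the line meets S(u_l).

open import Defs
open import Level using (Level)
open import Data.Nat using (ℕ; suc; _<_; _≤_; _^_)
open import Data.Nat.Primality using (Prime)
open import Data.Fin using (Fin)
open import Data.Product using (Σ; _×_; _,_; ∃)
open import Relation.Nullary using (¬_)
open import Relation.Binary.PropositionalEquality using (_≡_)
open import Algebra.Bundles using (CommutativeRing)

open import Level using (_⊔_)
open import Data.Nat as ℕ using (zero; s≤s; z≤n; _!)
import Data.Nat.Properties as ℕ
open import Data.Nat.Divisibility using (_∣_; divides; ∣1⇒≡1; ∣⇒≤; m∣m*n)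
open import Data.Nat.DivMod using (m*[n/m]≡n)
open import Data.Nat.Combinatorics using (_C_; nCk≡n!/k![n-k]!; k![n∸k]!∣n!; nCn≡1)
open import Data.Nat.Primality using (euclidsLemma; prime⇒nonTrivial)
import Data.Integer as ℤ
open import Data.Fin as Fin using (zero; suc; punchIn; punchOut; toℕ; fromℕ)
import Data.Fin.Properties as Fin
open import Data.Fin.Patterns using (0F; 1F)
open import Data.Fin.Permutation.Components using (transpose; transpose-inverse)
open import Data.Vec.Functional using (_∷_; updateAt)
open import Data.Vec.Functional.Properties using (updateAt-updates; updateAt-minimal)
open import Data.Empty using (⊥-elim)
open import Data.Sum using (inj₁; inj₂)
open import Data.Product using (proj₁; proj₂)
open import Function using (_∘_)
open import Relation.Nullary using (yes; no)
open import Relation.Binary.Definitions using (Decidable)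
import Relation.Binary.PropositionalEquality as ≡
open ≡ using (_≢_)

-- The solver normalises coefficients by computation, so they are taken in ℤ (read as n · 1#):
-- equality in R itself need not be decidable.
module IntegerCoefficientSolver {c ℓ} (R : CommutativeRing c ℓ) where
  open import Data.Integer using (ℤ; +_; -[1+_]; _⊖_; _◃_; sign; ∣_∣)
  import Data.Integer.Properties as ℤ
  open import Data.Sign as Sign using (Sign)
  open import Data.Maybe using (just; nothing)
  open import Algebra.Solver.Ring.AlmostCommutativeRing
    using (AlmostCommutativeRing; fromCommutativeRing; _-Raw-AlmostCommutative⟶_; Induced-equivalence)
  open import Relation.Binary.Definitions using (WeaklyDecidable)
  open CommutativeRing R hiding (zero)
  open import Algebra.Properties.Semiring.Mult semiring renaming (_×_ to _·_)
  open import Algebra.Properties.Ring ring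
  open import Relation.Binary.Reasoning.Setoid setoid

  ⟦_⟧ℤ : ℤ → Carrier
  ⟦ + n ⟧ℤ      = n · 1#
  ⟦ -[1+ n ] ⟧ℤ = - (suc n · 1#)

  ⟦_⟧ₛ : Sign → Carrier
  ⟦ Sign.+ ⟧ₛ = 1#
  ⟦ Sign.- ⟧ₛ = - 1#

  ⟦◃⟧ : ∀ s n → ⟦ s ◃ n ⟧ℤ ≈ ⟦ s ⟧ₛ * (n · 1#)
  ⟦◃⟧ s      zero    = sym (zeroʳ _)
  ⟦◃⟧ Sign.+ (suc n) = sym (*-identityˡ _)
  ⟦◃⟧ Sign.- (suc n) = trans (-‿cong (sym (*-identityˡ _))) (-‿distribˡ-* 1# _)

  ⟦⟧ℤ-sign-abs : ∀ i → ⟦ i ⟧ℤ ≈ ⟦ sign i ⟧ₛ * (∣ i ∣ · 1#)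
  ⟦⟧ℤ-sign-abs i = trans (reflexive (≡.cong ⟦_⟧ℤ (≡.sym (ℤ.◃-inverse i)))) (⟦◃⟧ (sign i) ∣ i ∣)

  ⟦⟧ₛ-homo-* : ∀ s t → ⟦ s Sign.* t ⟧ₛ ≈ ⟦ s ⟧ₛ * ⟦ t ⟧ₛ
  ⟦⟧ₛ-homo-* Sign.+ t      = sym (*-identityˡ _)
  ⟦⟧ₛ-homo-* Sign.- Sign.+ = sym (*-identityʳ _)
  ⟦⟧ₛ-homo-* Sign.- Sign.- = trans (sym (-‿involutive 1#)) (trans (-‿cong (sym (*-identityˡ _))) (-‿distribˡ-* 1# (- 1#)))

  ⟦⟧ℤ-homo-* : ∀ i j → ⟦ i ℤ.* j ⟧ℤ ≈ ⟦ i ⟧ℤ * ⟦ j ⟧ℤ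
  ⟦⟧ℤ-homo-* i j = begin
    ⟦ i ℤ.* j ⟧ℤ
      ≈⟨ ⟦◃⟧ (sign i Sign.* sign j) (∣ i ∣ ℕ.* ∣ j ∣) ⟩
    ⟦ sign i Sign.* sign j ⟧ₛ * ((∣ i ∣ ℕ.* ∣ j ∣) · 1#)
      ≈⟨ *-cong (⟦⟧ₛ-homo-* (sign i) (sign j)) (×1-homo-* ∣ i ∣ ∣ j ∣) ⟩
    (si * sj) * (ni * nj)
      ≈⟨ *-assoc si sj _ ⟩
    si * (sj * (ni * nj))
      ≈⟨ *-congˡ (trans (sym (*-assoc sj ni nj)) (trans (*-congʳ (*-comm sj ni)) (*-assoc ni sj nj))) ⟩
    si * (ni * (sj * nj))
      ≈⟨ sym (*-assoc si ni _) ⟩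
    (si * ni) * (sj * nj)
      ≈⟨ sym (*-cong (⟦⟧ℤ-sign-abs i) (⟦⟧ℤ-sign-abs j)) ⟩
    ⟦ i ⟧ℤ * ⟦ j ⟧ℤ ∎
    where
    si = ⟦ sign i ⟧ₛ
    sj = ⟦ sign j ⟧ₛ
    ni = ∣ i ∣ · 1#
    nj = ∣ j ∣ · 1#

  ⟦⊖⟧ : ∀ m n → ⟦ m ⊖ n ⟧ℤ ≈ m · 1# - n · 1#
  ⟦⊖⟧ zero    zero    = sym (-‿inverseʳ _)
  ⟦⊖⟧ zero    (suc n) = sym (+-identityˡ _)
  ⟦⊖⟧ (suc m) zero    = sym (trans (+-congˡ -0#≈0#) (+-identityʳ _))
  ⟦⊖⟧ (suc m) (suc n) = begin
    ⟦ suc m ⊖ suc n ⟧ℤ           ≈⟨ reflexive (≡.cong ⟦_⟧ℤ (ℤ.[1+m]⊖[1+n]≡m⊖n m n)) ⟩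
    ⟦ m ⊖ n ⟧ℤ                   ≈⟨ ⟦⊖⟧ m n ⟩
    x - y                        ≈⟨ sym (+-congʳ (trans (+-congʳ (-‿inverseʳ 1#)) (+-identityˡ x))) ⟩
    ((1# - 1#) + x) - y          ≈⟨ +-congʳ (trans (+-congʳ (+-comm 1# (- 1#))) (+-assoc (- 1#) 1# x)) ⟩
    (- 1# + (1# + x)) - y        ≈⟨ +-assoc (- 1#) _ _ ⟩
    - 1# + ((1# + x) - y)        ≈⟨ +-comm (- 1#) _ ⟩
    ((1# + x) - y) - 1#          ≈⟨ +-assoc (1# + x) _ _ ⟩
    (1# + x) + (- y - 1#)        ≈⟨ +-congˡ (trans (+-comm (- y) (- 1#)) (-‿+-comm 1# y)) ⟩
    (1# + x) - (1# + y)          ∎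
    where
    x = m · 1#
    y = n · 1#

  ⟦⟧ℤ-homo-+ : ∀ i j → ⟦ i ℤ.+ j ⟧ℤ ≈ ⟦ i ⟧ℤ + ⟦ j ⟧ℤ
  ⟦⟧ℤ-homo-+ (+ m)    (+ n)    = ×-homo-+ 1# m n
  ⟦⟧ℤ-homo-+ (+ m)    -[1+ n ] = ⟦⊖⟧ m (suc n)
  ⟦⟧ℤ-homo-+ -[1+ m ] (+ n)    = trans (⟦⊖⟧ n (suc m)) (+-comm _ _)
  ⟦⟧ℤ-homo-+ -[1+ m ] -[1+ n ] = begin
    - (suc (suc (m ℕ.+ n)) · 1#) ≈⟨ -‿cong (reflexive (≡.cong (λ k → suc k · 1#) (≡.sym (ℕ.+-suc m n)))) ⟩
    - ((suc m ℕ.+ suc n) · 1#)   ≈⟨ -‿cong (×-homo-+ 1# (suc m) (suc n)) ⟩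
    - (suc m · 1# + suc n · 1#)  ≈⟨ sym (-‿+-comm _ _) ⟩
    - (suc m · 1#) - suc n · 1#  ∎

  ⟦⟧ℤ-homo-‿ : ∀ i → ⟦ ℤ.- i ⟧ℤ ≈ - ⟦ i ⟧ℤ
  ⟦⟧ℤ-homo-‿ -[1+ n ]      = sym (-‿involutive _)
  ⟦⟧ℤ-homo-‿ (+ zero)      = sym -0#≈0#
  ⟦⟧ℤ-homo-‿ (+ suc n)     = refl

  private
    F : AlmostCommutativeRing c ℓ
    F = fromCommutativeRing R

    ⟦⟧ℤ-morphism : CommutativeRing.rawRing ℤ.+-*-commutativeRing -Raw-AlmostCommutative⟶ F
    ⟦⟧ℤ-morphism = record
      { ⟦_⟧    = ⟦_⟧ℤ
      ; +-homo = ⟦⟧ℤ-homo-+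
      ; *-homo = ⟦⟧ℤ-homo-*
      ; -‿homo = ⟦⟧ℤ-homo-‿
      ; 0-homo = refl
      ; 1-homo = +-identityʳ 1#
      }

    ≟-weak : WeaklyDecidable (Induced-equivalence ⟦⟧ℤ-morphism)
    ≟-weak i j with i ℤ.≟ j
    ... | yes i≡j = just (reflexive (≡.cong ⟦_⟧ℤ i≡j))
    ... | no _    = nothing

  open import Algebra.Solver.Ring (CommutativeRing.rawRing ℤ.+-*-commutativeRing) F ⟦⟧ℤ-morphism ≟-weak public

module RingLemmas {c ℓ} (R : CommutativeRing c ℓ) where
  open CommutativeRing R hiding (zero)
  open import Algebra.Properties.Ring ring using (-‿involutive; -0#≈0#)
  open FieldDefs R
  open IntegerCoefficientSolver R using (solve; _:+_; _:*_; _:-_; :-_; _:=_)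
  open import Relation.Binary.Reasoning.Setoid setoid

  x-y≈0⇒x≈y : ∀ {x y} → x - y ≈ 0# → x ≈ y
  x-y≈0⇒x≈y {x} {y} x-y≈0 = begin
    x            ≈⟨ solve 2 (λ x y → x := (x :- y) :+ y) refl x y ⟩
    (x - y) + y  ≈⟨ +-congʳ x-y≈0 ⟩
    0# + y       ≈⟨ +-identityˡ y ⟩
    y            ∎

  x≈y⇒x-y≈0 : ∀ {x y} → x ≈ y → x - y ≈ 0#
  x≈y⇒x-y≈0 {x} {y} x≈y = trans (+-congʳ x≈y) (-‿inverseʳ y)

  -x≈0⇒x≈0 : ∀ {x} → - x ≈ 0# → x ≈ 0#
  -x≈0⇒x≈0 {x} -x≈0 = trans (sym (-‿involutive x)) (trans (-‿cong -x≈0) -0#≈0#)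

  ∑-cong : ∀ m {f g : Fin m → Carrier} → (∀ i → f i ≈ g i) → ∑ m f ≈ ∑ m g
  ∑-cong zero    f≈g = refl
  ∑-cong (suc m) f≈g = +-cong (f≈g zero) (∑-cong m (λ i → f≈g (suc i)))

  ∑-zero : ∀ m {f : Fin m → Carrier} → (∀ i → f i ≈ 0#) → ∑ m f ≈ 0#
  ∑-zero zero    f≈0 = refl
  ∑-zero (suc m) f≈0 = trans (+-cong (f≈0 zero) (∑-zero m (λ i → f≈0 (suc i)))) (+-identityˡ 0#)

  ∑-distrib-+ : ∀ m (f g : Fin m → Carrier) → ∑ m (λ i → f i + g i) ≈ ∑ m f + ∑ m g
  ∑-distrib-+ zero    f g = sym (+-identityˡ 0#)
  ∑-distrib-+ (suc m) f g = trans (+-congˡ (∑-distrib-+ m _ _))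
    (solve 4 (λ a b c d → (a :+ b) :+ (c :+ d) := (a :+ c) :+ (b :+ d)) refl
      (f zero) (g zero) (∑ m (λ i → f (suc i))) (∑ m (λ i → g (suc i))))

  ∑-distribˡ-* : ∀ m a (f : Fin m → Carrier) → ∑ m (λ i → a * f i) ≈ a * ∑ m f
  ∑-distribˡ-* zero    a f = sym (zeroʳ a)
  ∑-distribˡ-* (suc m) a f = trans (+-congˡ (∑-distribˡ-* m a _)) (sym (distribˡ a _ _))

  ∑-single : ∀ m {f : Fin m → Carrier} r → (∀ i → i ≢ r → f i ≈ 0#) → ∑ m f ≈ f r
  ∑-single (suc m) zero    f≈0 =
    trans (+-congˡ (∑-zero m (λ i → f≈0 (suc i) (λ ())))) (+-identityʳ _)
  ∑-single (suc m) (suc r) f≈0 =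
    trans (+-cong (f≈0 zero (λ ())) (∑-single m r (λ i i≢r → f≈0 (suc i) (i≢r ∘ Fin.suc-injective))))
          (+-identityˡ _)

  ∑-pair : ∀ m {f : Fin m → Carrier} r s → r ≢ s → (∀ i → i ≢ r → i ≢ s → f i ≈ 0#) →
           ∑ m f ≈ f r + f s
  ∑-pair (suc m) zero    zero    r≢s f≈0 = ⊥-elim (r≢s ≡.refl)
  ∑-pair (suc m) zero    (suc s) r≢s f≈0 =
    +-congˡ (∑-single m s (λ i i≢s → f≈0 (suc i) (λ ()) (i≢s ∘ Fin.suc-injective)))
  ∑-pair (suc m) (suc r) zero    r≢s f≈0 =
    trans (+-congˡ (∑-single m r (λ i i≢r → f≈0 (suc i) (i≢r ∘ Fin.suc-injective) (λ ())))) (+-comm _ _)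
  ∑-pair (suc m) (suc r) (suc s) r≢s f≈0 =
    trans (+-cong (f≈0 zero (λ ()) (λ ()))
                  (∑-pair m r s (r≢s ∘ ≡.cong suc) (λ i i≢r i≢s → f≈0 (suc i) (i≢r ∘ Fin.suc-injective) (i≢s ∘ Fin.suc-injective))))
          (+-identityˡ _)

  ∑ᶠ : ∀ {n} d → ((Fin d → Fin n) → Carrier) → Carrier
  ∑ᶠ     zero    G = G (λ ())
  ∑ᶠ {n} (suc d) G = ∑ n (λ j → ∑ᶠ d (λ J → G (j ∷ J)))

  ∑ᶠ-cong : ∀ {n} d {G H : (Fin d → Fin n) → Carrier} → (∀ J → G J ≈ H J) → ∑ᶠ d G ≈ ∑ᶠ d H
  ∑ᶠ-cong     zero    G≈H = G≈H _
  ∑ᶠ-cong {n} (suc d) G≈H = ∑-cong n (λ j → ∑ᶠ-cong d (λ J → G≈H _))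

  ∑ᶠ-zero : ∀ {n} d {G : (Fin d → Fin n) → Carrier} → (∀ J → G J ≈ 0#) → ∑ᶠ d G ≈ 0#
  ∑ᶠ-zero     zero    G≈0 = G≈0 _
  ∑ᶠ-zero {n} (suc d) G≈0 = ∑-zero n (λ j → ∑ᶠ-zero d (λ J → G≈0 _))

  ∑ᶠ-distrib-+ : ∀ {n} d (G H : (Fin d → Fin n) → Carrier) → ∑ᶠ d (λ J → G J + H J) ≈ ∑ᶠ d G + ∑ᶠ d H
  ∑ᶠ-distrib-+     zero    G H = refl
  ∑ᶠ-distrib-+ {n} (suc d) G H = trans (∑-cong n (λ j → ∑ᶠ-distrib-+ d _ _)) (∑-distrib-+ n _ _)

  ∑ᶠ-distribˡ-* : ∀ {n} d a (G : (Fin d → Fin n) → Carrier) → ∑ᶠ d (λ J → a * G J) ≈ a * ∑ᶠ d G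
  ∑ᶠ-distribˡ-*     zero    a G = refl
  ∑ᶠ-distribˡ-* {n} (suc d) a G = trans (∑-cong n (λ j → ∑ᶠ-distribˡ-* d a _)) (∑-distribˡ-* n a _)

  ∑-∑ᶠ-comm : ∀ {n} d K (G : Fin K → (Fin d → Fin n) → Carrier) → ∑ K (λ k → ∑ᶠ d (G k)) ≈ ∑ᶠ d (λ J → ∑ K (λ k → G k J))
  ∑-∑ᶠ-comm d zero    G = sym (∑ᶠ-zero d (λ J → refl))
  ∑-∑ᶠ-comm d (suc K) G = trans (+-congˡ (∑-∑ᶠ-comm d K (G ∘ suc))) (sym (∑ᶠ-distrib-+ d _ _))

  ∏-cong : ∀ m {f g : Fin m → Carrier} → (∀ i → f i ≈ g i) → ∏ m f ≈ ∏ m g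
  ∏-cong zero    f≈g = refl
  ∏-cong (suc m) f≈g = *-cong (f≈g zero) (∏-cong m (λ i → f≈g (suc i)))

  ∏-distrib-* : ∀ m (f g : Fin m → Carrier) → ∏ m (λ i → f i * g i) ≈ ∏ m f * ∏ m g
  ∏-distrib-* zero    f g = sym (*-identityˡ 1#)
  ∏-distrib-* (suc m) f g = trans (*-congˡ (∏-distrib-* m _ _))
    (solve 4 (λ a b c d → (a :* b) :* (c :* d) := (a :* c) :* (b :* d)) refl
      (f zero) (g zero) (∏ m (λ i → f (suc i))) (∏ m (λ i → g (suc i))))

  ∏-zero : ∀ m {f : Fin m → Carrier} i → f i ≈ 0# → ∏ m f ≈ 0#
  ∏-zero (suc m) zero    fi≈0 = trans (*-congʳ fi≈0) (zeroˡ _)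
  ∏-zero (suc m) (suc i) fi≈0 = trans (*-congˡ (∏-zero m i fi≈0)) (zeroʳ _)

  ∏-∑-distrib : ∀ {n} d (f : Fin d → Fin n → Carrier) → ∏ d (λ i → ∑ n (f i)) ≈ ∑ᶠ d (λ J → ∏ d (λ i → f i (J i)))
  ∏-∑-distrib     zero    f = refl
  ∏-∑-distrib {n} (suc d) f = begin
    ∑ n (f zero) * ∏ d (λ i → ∑ n (f (suc i)))  ≈⟨ *-congˡ (∏-∑-distrib d (f ∘ suc)) ⟩
    ∑ n (f zero) * P                            ≈⟨ *-comm _ _ ⟩
    P * ∑ n (f zero)                            ≈⟨ sym (∑-distribˡ-* n P _) ⟩
    ∑ n (λ j → P * f zero j)                    ≈⟨ ∑-cong n (λ j → trans (*-comm _ _) (sym (∑ᶠ-distribˡ-* d (f zero j) _))) ⟩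
    ∑ n (λ j → ∑ᶠ d (λ J → f zero j * ∏ d (λ i → f (suc i) (J i)))) ∎
    where P = ∑ᶠ d (λ J → ∏ d (λ i → f (suc i) (J i)))

  ∏-updateAt : ∀ m (f : Fin m → Carrier) i → ∏ m f ≈ f i * ∏ m (updateAt f i (λ _ → 1#))
  ∏-updateAt (suc m) f zero    = *-congˡ (sym (*-identityˡ _))
  ∏-updateAt (suc m) f (suc i) = begin
    f zero * ∏ m (f ∘ suc)
      ≈⟨ *-congˡ (∏-updateAt m (f ∘ suc) i) ⟩
    f zero * (f (suc i) * ∏ m (updateAt (f ∘ suc) i (λ _ → 1#)))
      ≈⟨ solve 3 (λ a b c → a :* (b :* c) := b :* (a :* c)) refl _ _ _ ⟩
    f (suc i) * (f zero * ∏ m (updateAt (f ∘ suc) i (λ _ → 1#))) ∎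

  ∏-updateAt₂ : ∀ m (f : Fin m → Carrier) {i j} → i ≢ j →
                ∏ m f ≈ f i * (f j * ∏ m (updateAt (updateAt f i (λ _ → 1#)) j (λ _ → 1#)))
  ∏-updateAt₂ m f {i} {j} i≢j = trans (∏-updateAt m f i) (*-congˡ (trans (∏-updateAt m _ j)
    (*-congʳ (reflexive (updateAt-minimal j i f (i≢j ∘ ≡.sym))))))

  ∏-updateAt₂-cong : ∀ m {f g : Fin m → Carrier} i j → (∀ k → k ≢ i → k ≢ j → f k ≈ g k) →
                     ∏ m (updateAt (updateAt f i (λ _ → 1#)) j (λ _ → 1#)) ≈ ∏ m (updateAt (updateAt g i (λ _ → 1#)) j (λ _ → 1#))
  ∏-updateAt₂-cong m {f} {g} i j f≈g = ∏-cong m agree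
    where
    agree : ∀ k → updateAt (updateAt f i (λ _ → 1#)) j (λ _ → 1#) k ≈ updateAt (updateAt g i (λ _ → 1#)) j (λ _ → 1#) k
    agree k with k Fin.≟ j | k Fin.≟ i
    ... | yes ≡.refl | _ = reflexive (≡.trans (updateAt-updates k _) (≡.sym (updateAt-updates k _)))
    ... | no k≢j | yes ≡.refl = reflexive (≡.trans (updateAt-minimal k j _ k≢j)
                                  (≡.trans (updateAt-updates k f) (≡.sym (≡.trans (updateAt-minimal k j _ k≢j) (updateAt-updates k g)))))
    ... | no k≢j | no k≢i = begin
      updateAt (updateAt f i (λ _ → 1#)) j (λ _ → 1#) k ≡⟨ ≡.trans (updateAt-minimal k j _ k≢j) (updateAt-minimal k i f k≢i) ⟩
      f k ≈⟨ f≈g k k≢i k≢j ⟩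
      g k ≡⟨ ≡.sym (≡.trans (updateAt-minimal k j _ k≢j) (updateAt-minimal k i g k≢i)) ⟩
      updateAt (updateAt g i (λ _ → 1#)) j (λ _ → 1#) k ∎

  pow-cong : ∀ {x y} n → x ≈ y → pow x n ≈ pow y n
  pow-cong zero    x≈y = refl
  pow-cong (suc n) x≈y = *-cong x≈y (pow-cong n x≈y)

  pow-+ : ∀ x m n → pow x (m ℕ.+ n) ≈ pow x m * pow x n
  pow-+ x zero    n = sym (*-identityˡ _)
  pow-+ x (suc m) n = trans (*-congˡ (pow-+ x m n)) (sym (*-assoc _ _ _))

  pow-* : ∀ x m n → pow x (m ℕ.* n) ≈ pow (pow x m) n
  pow-* x m zero    = reflexive (≡.cong (pow x) (ℕ.*-zeroʳ m))
  pow-* x m (suc n) = begin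
    pow x (m ℕ.* suc n)        ≈⟨ reflexive (≡.cong (pow x) (ℕ.*-suc m n)) ⟩
    pow x (m ℕ.+ m ℕ.* n)      ≈⟨ pow-+ x m (m ℕ.* n) ⟩
    pow x m * pow x (m ℕ.* n)  ≈⟨ *-congˡ (pow-* x m n) ⟩
    pow x m * pow (pow x m) n  ∎

  pow-distrib-* : ∀ x y n → pow (x * y) n ≈ pow x n * pow y n
  pow-distrib-* x y zero    = sym (*-identityˡ 1#)
  pow-distrib-* x y (suc n) = trans (*-congˡ (pow-distrib-* x y n))
    (solve 4 (λ a b c d → (a :* b) :* (c :* d) := (a :* c) :* (b :* d)) refl x y (pow x n) (pow y n))

  det : Carrier → Carrier → Carrier → Carrier → Carrier
  det a b c d = a * d - b * c

  det-antisym : ∀ a b c d → det a b c d ≈ - det c d a b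
  det-antisym a b c d = solve 4 (λ a b c d → a :* d :- b :* c := :- (c :* b :- d :* a)) refl a b c d

  cramer : ∀ x₀ x₁ v₀ v₁ y₀ y₁ →
    (det x₀ x₁ v₀ v₁ * y₀ ≈ det y₀ y₁ v₀ v₁ * x₀ + det x₀ x₁ y₀ y₁ * v₀) ×
    (det x₀ x₁ v₀ v₁ * y₁ ≈ det y₀ y₁ v₀ v₁ * x₁ + det x₀ x₁ y₀ y₁ * v₁)
  cramer x₀ x₁ v₀ v₁ y₀ y₁ =
    solve 6 (λ x₀ x₁ v₀ v₁ y₀ y₁ → (x₀ :* v₁ :- x₁ :* v₀) :* y₀ := (y₀ :* v₁ :- y₁ :* v₀) :* x₀ :+ (x₀ :* y₁ :- x₁ :* y₀) :* v₀)
      refl x₀ x₁ v₀ v₁ y₀ y₁ ,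
    solve 6 (λ x₀ x₁ v₀ v₁ y₀ y₁ → (x₀ :* v₁ :- x₁ :* v₀) :* y₁ := (y₀ :* v₁ :- y₁ :* v₀) :* x₁ :+ (x₀ :* y₁ :- x₁ :* y₀) :* v₁)
      refl x₀ x₁ v₀ v₁ y₀ y₁

  det-combination : ∀ u₀ u₁ v₀ v₁ w₀ w₁ x₀ x₁ p q s g h →
    s * w₀ ≈ p * u₀ + q * v₀ → s * w₁ ≈ p * u₁ + q * v₁ →
    det u₀ u₁ v₀ v₁ * det (h * p * u₀ + g * q * v₀) (h * p * u₁ + g * q * v₁) x₀ x₁
      ≈ s * (h * det w₀ w₁ v₀ v₁ * det u₀ u₁ x₀ x₁ + g * det u₀ u₁ w₀ w₁ * det v₀ v₁ x₀ x₁)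
  det-combination u₀ u₁ v₀ v₁ w₀ w₁ x₀ x₁ p q s g h sw₀≈ sw₁≈ = begin
    det u₀ u₁ v₀ v₁ * det (h * p * u₀ + g * q * v₀) (h * p * u₁ + g * q * v₁) x₀ x₁
      ≈⟨ solve 10 (λ u₀ u₁ v₀ v₁ x₀ x₁ p q g h →
           (u₀ :* v₁ :- u₁ :* v₀) :* ((h :* p :* u₀ :+ g :* q :* v₀) :* x₁ :- (h :* p :* u₁ :+ g :* q :* v₁) :* x₀)
           := h :* ((p :* u₀ :+ q :* v₀) :* v₁ :- (p :* u₁ :+ q :* v₁) :* v₀) :* (u₀ :* x₁ :- u₁ :* x₀)
              :+ g :* (u₀ :* (p :* u₁ :+ q :* v₁) :- u₁ :* (p :* u₀ :+ q :* v₀)) :* (v₀ :* x₁ :- v₁ :* x₀))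
         refl u₀ u₁ v₀ v₁ x₀ x₁ p q g h ⟩
    h * ((p * u₀ + q * v₀) * v₁ - (p * u₁ + q * v₁) * v₀) * det u₀ u₁ x₀ x₁
      + g * (u₀ * (p * u₁ + q * v₁) - u₁ * (p * u₀ + q * v₀)) * det v₀ v₁ x₀ x₁
      ≈⟨ sym (+-cong (*-congʳ (*-congˡ (+-cong (*-congʳ sw₀≈) (-‿cong (*-congʳ sw₁≈)))))
                     (*-congʳ (*-congˡ (+-cong (*-congˡ sw₁≈) (-‿cong (*-congˡ sw₀≈)))))) ⟩
    h * ((s * w₀) * v₁ - (s * w₁) * v₀) * det u₀ u₁ x₀ x₁
      + g * (u₀ * (s * w₁) - u₁ * (s * w₀)) * det v₀ v₁ x₀ x₁
      ≈⟨ solve 11 (λ u₀ u₁ v₀ v₁ w₀ w₁ x₀ x₁ s g h →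
           h :* ((s :* w₀) :* v₁ :- (s :* w₁) :* v₀) :* (u₀ :* x₁ :- u₁ :* x₀)
             :+ g :* (u₀ :* (s :* w₁) :- u₁ :* (s :* w₀)) :* (v₀ :* x₁ :- v₁ :* x₀)
           := s :* (h :* (w₀ :* v₁ :- w₁ :* v₀) :* (u₀ :* x₁ :- u₁ :* x₀) :+ g :* (u₀ :* w₁ :- u₁ :* w₀) :* (v₀ :* x₁ :- v₁ :* x₀)))
         refl u₀ u₁ v₀ v₁ w₀ w₁ x₀ x₁ s g h ⟩
    s * (h * det w₀ w₁ v₀ v₁ * det u₀ u₁ x₀ x₁ + g * det u₀ u₁ w₀ w₁ * det v₀ v₁ x₀ x₁) ∎

  record IsInjectiveHom (σ : Carrier → Carrier) : Set (c ⊔ ℓ) where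
    field
      cong    : ∀ {x y} → x ≈ y → σ x ≈ σ y
      +-homo  : ∀ x y → σ (x + y) ≈ σ x + σ y
      *-homo  : ∀ x y → σ (x * y) ≈ σ x * σ y
      kernel  : ∀ x → σ x ≈ 0# → x ≈ 0#

    0#-homo : σ 0# ≈ 0#
    0#-homo = begin
      σ 0#                  ≈⟨ solve 1 (λ a → a := (a :+ a) :- a) refl (σ 0#) ⟩
      (σ 0# + σ 0#) - σ 0#  ≈⟨ +-congʳ (sym (trans (cong (sym (+-identityˡ 0#))) (+-homo 0# 0#))) ⟩
      σ 0# - σ 0#           ≈⟨ -‿inverseʳ _ ⟩
      0#                    ∎

    -‿homo : ∀ x → σ (- x) ≈ - σ x
    -‿homo x = begin
      σ (- x)                  ≈⟨ solve 2 (λ a b → a := (a :+ b) :- b) refl (σ (- x)) (σ x) ⟩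
      (σ (- x) + σ x) - σ x    ≈⟨ +-congʳ (sym (+-homo (- x) x)) ⟩
      σ (- x + x) - σ x        ≈⟨ +-congʳ (trans (cong (-‿inverseˡ x)) 0#-homo) ⟩
      0# - σ x                 ≈⟨ +-identityˡ _ ⟩
      - σ x                    ∎

    det-homo : ∀ a b c d → σ (det a b c d) ≈ det (σ a) (σ b) (σ c) (σ d)
    det-homo a b c d = trans (+-homo _ _) (+-cong (*-homo a d) (trans (-‿homo _) (-‿cong (*-homo b c))))

    ∑-homo : ∀ m (f : Fin m → Carrier) → σ (∑ m f) ≈ ∑ m (σ ∘ f)
    ∑-homo zero    f = 0#-homo
    ∑-homo (suc m) f = trans (+-homo _ _) (+-congˡ (∑-homo m _))

    ≉0-homo : ∀ {x} → x ≉ 0# → σ x ≉ 0#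
    ≉0-homo x≉0 σx≈0 = x≉0 (kernel _ σx≈0)

  ι-sum : ∀ d (c : Fin d → Carrier) (w : Fin d → Vect 2) β j → ∑ d (λ κ → c κ * ι κ (w κ) β j) ≈ c β * w β j
  ι-sum d c w β j = trans (∑-single d β ι-other) ι-same
    where
    ι-other : ∀ κ → κ ≢ β → c κ * ι κ (w κ) β j ≈ 0#
    ι-other κ κ≢β with κ Fin.≟ β
    ... | yes κ≡β = ⊥-elim (κ≢β κ≡β)
    ... | no  _   = zeroʳ _
    ι-same : c β * ι β (w β) β j ≈ c β * w β j
    ι-same with β Fin.≟ β
    ... | yes _   = refl
    ... | no  β≢β = ⊥-elim (β≢β ≡.refl)

module FieldLemmas {c ℓ} (R : CommutativeRing c ℓ) (isField : FieldDefs.IsField R)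
                   (_≟_ : Decidable (CommutativeRing._≈_ R)) where
  open CommutativeRing R hiding (zero)
  open FieldDefs R
  open RingLemmas R
  open IntegerCoefficientSolver R using (solve; _:+_; _:*_; _:-_; _:=_; con)
  open import Relation.Binary.Reasoning.Setoid setoid

  1≉0 : 1# ≉ 0#
  1≉0 = proj₁ isField

  _⁻¹[_] : ∀ x → x ≉ 0# → Carrier
  x ⁻¹[ x≉0 ] = proj₁ (proj₂ isField x x≉0)

  *-inverseʳ : ∀ x (x≉0 : x ≉ 0#) → x * x ⁻¹[ x≉0 ] ≈ 1#
  *-inverseʳ x x≉0 = proj₂ (proj₂ isField x x≉0)

  x*y≈0⇒y≈0 : ∀ {x y} → x ≉ 0# → x * y ≈ 0# → y ≈ 0#
  x*y≈0⇒y≈0 {x} {y} x≉0 xy≈0 = begin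
    y                    ≈⟨ sym (*-identityˡ y) ⟩
    1# * y               ≈⟨ *-congʳ (sym (trans (*-comm _ _) (*-inverseʳ x x≉0))) ⟩
    (x ⁻¹[ x≉0 ] * x) * y ≈⟨ *-assoc _ _ _ ⟩
    x ⁻¹[ x≉0 ] * (x * y) ≈⟨ *-congˡ xy≈0 ⟩
    x ⁻¹[ x≉0 ] * 0#      ≈⟨ zeroʳ _ ⟩
    0#                   ∎

  *-nonzero : ∀ {x y} → x ≉ 0# → y ≉ 0# → x * y ≉ 0#
  *-nonzero x≉0 y≉0 xy≈0 = y≉0 (x*y≈0⇒y≈0 x≉0 xy≈0)

  *-cancelˡ : ∀ {x y z} → x ≉ 0# → x * y ≈ x * z → y ≈ z
  *-cancelˡ {x} {y} {z} x≉0 xy≈xz = x-y≈0⇒x≈y (x*y≈0⇒y≈0 x≉0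
    (trans (solve 3 (λ x y z → x :* (y :- z) := x :* y :- x :* z) refl x y z) (x≈y⇒x-y≈0 xy≈xz)))

  *-solveˡ : ∀ {x y a z} (x≉0 : x ≉ 0#) → x * y ≈ a * z → y ≈ a * x ⁻¹[ x≉0 ] * z
  *-solveˡ {x} {y} {a} {z} x≉0 xy≈az = *-cancelˡ x≉0 (begin
    x * y                          ≈⟨ xy≈az ⟩
    a * z                          ≈⟨ sym (trans (*-congˡ (*-inverseʳ x x≉0)) (*-identityʳ _)) ⟩
    a * z * (x * x ⁻¹[ x≉0 ])       ≈⟨ solve 4 (λ a z x i → a :* z :* (x :* i) := x :* (a :* i :* z)) refl a z x _ ⟩
    x * (a * x ⁻¹[ x≉0 ] * z)       ∎)

  ∏-nonzero : ∀ m {f : Fin m → Carrier} → (∀ i → f i ≉ 0#) → ∏ m f ≉ 0#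
  ∏-nonzero zero    f≉0 = 1≉0
  ∏-nonzero (suc m) f≉0 = *-nonzero (f≉0 zero) (∏-nonzero m (f≉0 ∘ suc))

  pow-nonzero : ∀ {x} n → x ≉ 0# → pow x n ≉ 0#
  pow-nonzero zero    x≉0 = 1≉0
  pow-nonzero (suc n) x≉0 = *-nonzero x≉0 (pow-nonzero n x≉0)

  pow≈0⇒x≈0 : ∀ {x} n → pow x n ≈ 0# → x ≈ 0#
  pow≈0⇒x≈0 {x} n xⁿ≈0 with x ≟ 0#
  ... | yes x≈0 = x≈0
  ... | no  x≉0 = ⊥-elim (pow-nonzero n x≉0 xⁿ≈0)

  nonzero-term : ∀ {m} (f : Fin m → Carrier) → ¬ (∀ k → f k ≈ 0#) → ∃ λ k → f k ≉ 0#
  nonzero-term {m} f f≢0 = Fin.¬∀⟶∃¬ m (λ k → f k ≈ 0#) (λ k → f k ≟ 0#) f≢0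

  cross-multiply : ∀ {x y u v u′ v′} → x ≉ 0# → x * u + y * v ≈ 0# → x * u′ + y * v′ ≈ 0# → u * v′ ≈ u′ * v
  cross-multiply {x} {y} {u} {v} {u′} {v′} x≉0 e e′ = x-y≈0⇒x≈y (x*y≈0⇒y≈0 x≉0 (begin
    x * (u * v′ - u′ * v)
      ≈⟨ solve 6 (λ x y u v u′ v′ → x :* (u :* v′ :- u′ :* v) := (x :* u :+ y :* v) :* v′ :- (x :* u′ :+ y :* v′) :* v)
          refl x y u v u′ v′ ⟩
    (x * u + y * v) * v′ - (x * u′ + y * v′) * v
      ≈⟨ +-cong (trans (*-congʳ e) (zeroˡ _)) (-‿cong (trans (*-congʳ e′) (zeroˡ _))) ⟩
    0# - 0#
      ≈⟨ -‿inverseʳ 0# ⟩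
    0# ∎))

  det≈0⇒proportional : ∀ {u₀ u₁ v₀ v₁} → ¬ ((u₀ ≈ 0#) × (u₁ ≈ 0#)) → det u₀ u₁ v₀ v₁ ≈ 0# →
                       ∃ λ k → (v₀ ≈ k * u₀) × (v₁ ≈ k * u₁)
  det≈0⇒proportional {u₀} {u₁} {v₀} {v₁} u≉0 det≈0 with u₀ ≟ 0# | u₁ ≟ 0#
  ... | no u₀≉0 | _ = v₀ * u₀ ⁻¹[ u₀≉0 ] , *-solveˡ u₀≉0 (*-comm u₀ v₀) , *-solveˡ u₀≉0 (trans u₀v₁≈u₁v₀ (*-comm u₁ v₀))
    where u₀v₁≈u₁v₀ = x-y≈0⇒x≈y det≈0
  ... | yes u₀≈0 | no u₁≉0 = v₁ * u₁ ⁻¹[ u₁≉0 ] , *-solveˡ u₁≉0 (trans (sym u₀v₁≈u₁v₀) (*-comm u₀ v₁)) , *-solveˡ u₁≉0 (*-comm u₁ v₁)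
    where u₀v₁≈u₁v₀ = x-y≈0⇒x≈y det≈0
  ... | yes u₀≈0 | yes u₁≈0 = ⊥-elim (u≉0 (u₀≈0 , u₁≈0))

  scale≈0-of-independent : ∀ {u₀ u₁ v₀ v₁ a b} → det u₀ u₁ v₀ v₁ ≉ 0# → b * v₀ ≈ a * u₀ → b * v₁ ≈ a * u₁ → b ≈ 0#
  scale≈0-of-independent {u₀} {u₁} {v₀} {v₁} {a} {b} det≉0 bv₀≈au₀ bv₁≈au₁ = x*y≈0⇒y≈0 det≉0 (begin
    det u₀ u₁ v₀ v₁ * b
      ≈⟨ solve 5 (λ u₀ u₁ v₀ v₁ b → (u₀ :* v₁ :- u₁ :* v₀) :* b := u₀ :* (b :* v₁) :- u₁ :* (b :* v₀)) refl u₀ u₁ v₀ v₁ b ⟩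
    u₀ * (b * v₁) - u₁ * (b * v₀)
      ≈⟨ +-cong (*-congˡ bv₁≈au₁) (-‿cong (*-congˡ bv₀≈au₀)) ⟩
    u₀ * (a * u₁) - u₁ * (a * u₀)
      ≈⟨ solve 3 (λ u₀ u₁ a → u₀ :* (a :* u₁) :- u₁ :* (a :* u₀) := con (ℤ.+ 0)) refl u₀ u₁ a ⟩
    0# ∎)

p∤m! : ∀ {p} → Prime p → ∀ m → m < p → ¬ (p ∣ m !)
p∤m! {p} p-prime zero    _   p∣1 = ℕ.<-irrefl (≡.sym (∣1⇒≡1 p∣1)) (ℕ.nonTrivial⇒n>1 p {{prime⇒nonTrivial p-prime}})
p∤m! {p} p-prime (suc m) m<p p∣m! with euclidsLemma (suc m) (m !) p-prime p∣m!
... | inj₁ p∣1+m = ℕ.<⇒≱ m<p (∣⇒≤ p∣1+m)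
... | inj₂ p∣m!  = p∤m! p-prime m (ℕ.<-trans (ℕ.n<1+n m) m<p) p∣m!

p∣pCk : ∀ {p k} → Prime p → 0 < k → k < p → p ∣ (p C k)
p∣pCk {suc p′} {k} p-prime 0<k k<p with euclidsLemma (k ! ℕ.* (p ℕ.∸ k) !) (p C k) p-prime p∣k![p-k]!*pCk
  where
  p = suc p′
  k≤p = ℕ.<⇒≤ k<p
  instance _ = ℕ._!*_!≢0 k (p ℕ.∸ k)
  p∣k![p-k]!*pCk : p ∣ (k ! ℕ.* (p ℕ.∸ k) !) ℕ.* (p C k)
  p∣k![p-k]!*pCk = ≡.subst (p ∣_)
    (≡.sym (≡.trans (≡.cong ((k ! ℕ.* (p ℕ.∸ k) !) ℕ.*_) (nCk≡n!/k![n-k]! k≤p)) (m*[n/m]≡n (k![n∸k]!∣n! k≤p))))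
    (m∣m*n (p′ !))
... | inj₂ p∣pCk = p∣pCk
... | inj₁ p∣k![p-k]! with euclidsLemma (k !) ((suc p′ ℕ.∸ k) !) p-prime p∣k![p-k]!
...   | inj₁ p∣k!     = ⊥-elim (p∤m! p-prime k k<p p∣k!)
...   | inj₂ p∣[p-k]! = ⊥-elim (p∤m! p-prime (suc p′ ℕ.∸ k) (ℕ.∸-monoʳ-< {suc p′} {k} {0} 0<k (ℕ.<⇒≤ k<p)) p∣[p-k]!)

module Characteristic {c ℓ} (R : CommutativeRing c ℓ) where
  open CommutativeRing R hiding (zero)
  open FieldDefs R
  open RingLemmas R
  open import Algebra.Properties.Semiring.Mult semiring renaming (_×_ to _·_)
  open import Algebra.Properties.CommutativeSemiring.Binomial commutativeSemiring
    using (theorem; binomialTerm; binomialExpansion; binomial)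
  open import Algebra.Properties.Semiring.Exp semiring using () renaming (_^_ to _^ʳ_)
  open import Algebra.Definitions.RawMonoid +-rawMonoid using (sum)
  open import Relation.Binary.Reasoning.Setoid setoid

  pow≈^ : ∀ x n → pow x n ≈ x ^ʳ n
  pow≈^ x zero    = refl
  pow≈^ x (suc n) = *-congˡ (pow≈^ x n)

  sum≈∑ : ∀ m (f : Fin m → Carrier) → sum f ≈ ∑ m f
  sum≈∑ zero    f = refl
  sum≈∑ (suc m) f = +-congˡ (sum≈∑ m (f ∘ suc))

  n·0≈0 : ∀ n → n · 0# ≈ 0#
  n·0≈0 n = trans (×-congʳ n (sym (zeroˡ 0#))) (trans (sym (×-assoc-* n 0# 0#)) (zeroʳ _))

  pⁿ·1≈[p·1]ⁿ : ∀ p n → (p ℕ.^ n) · 1# ≈ pow (p · 1#) n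
  pⁿ·1≈[p·1]ⁿ p zero    = +-identityʳ 1#
  pⁿ·1≈[p·1]ⁿ p (suc n) = trans (×1-homo-* p (p ℕ.^ n)) (*-congˡ (pⁿ·1≈[p·1]ⁿ p n))

  module _ {p : ℕ} (p-prime : Prime p) (p·1≈0 : p · 1# ≈ 0#) where
    p·x≈0 : ∀ x → p · x ≈ 0#
    p·x≈0 x = begin
      p · x          ≈⟨ ×-congʳ p (sym (*-identityˡ x)) ⟩
      p · (1# * x)   ≈⟨ sym (×-assoc-* p 1# x) ⟩
      (p · 1#) * x   ≈⟨ *-congʳ p·1≈0 ⟩
      0# * x         ≈⟨ zeroˡ x ⟩
      0#             ∎

    binomialTerm-inner : ∀ x y (k : Fin (suc p)) → k ≢ zero → k ≢ fromℕ p → binomialTerm x y p k ≈ 0#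
    binomialTerm-inner x y zero    0≢0 _   = ⊥-elim (0≢0 ≡.refl)
    binomialTerm-inner x y k@(suc _) _ k≢p with p∣pCk p-prime (s≤s z≤n) k<p
      where
      k<p : toℕ k < p
      k<p = ℕ.≤∧≢⇒< (ℕ.≤-pred (Fin.toℕ<n k)) (k≢p ∘ Fin.toℕ-injective ∘ λ e → ≡.trans e (≡.sym (Fin.toℕ-fromℕ p)))
    ... | divides m pCk≡m*p = begin
      (p C toℕ k) · binomial x y p k  ≈⟨ ×-congˡ pCk≡m*p ⟩
      (m ℕ.* p) · binomial x y p k    ≈⟨ sym (×-assocˡ _ m p) ⟩
      m · (p · binomial x y p k)      ≈⟨ ×-congʳ m (p·x≈0 _) ⟩
      m · 0#                          ≈⟨ n·0≈0 m ⟩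
      0#                              ∎

    freshman : ∀ x y → pow (x + y) p ≈ pow x p + pow y p
    freshman x y = begin
      pow (x + y) p
        ≈⟨ pow≈^ (x + y) p ⟩
      (x + y) ^ʳ p
        ≈⟨ theorem p x y ⟩
      binomialExpansion x y p
        ≈⟨ sum≈∑ (suc p) (binomialTerm x y p) ⟩
      ∑ (suc p) (binomialTerm x y p)
        ≈⟨ ∑-pair (suc p) zero (fromℕ p) 0≢p (λ k → binomialTerm-inner x y k) ⟩
      binomialTerm x y p zero + binomialTerm x y p (fromℕ p)
        ≈⟨ +-cong first last ⟩
      pow y p + pow x p
        ≈⟨ +-comm _ _ ⟩
      pow x p + pow y p ∎
      where
      0≢p : zero ≢ fromℕ p
      0≢p 0≡p = ℕ.<⇒≢ (ℕ.<-trans (s≤s z≤n) (ℕ.nonTrivial⇒n>1 p {{prime⇒nonTrivial p-prime}}))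
                      (≡.trans (≡.cong toℕ 0≡p) (Fin.toℕ-fromℕ p))
      first : binomialTerm x y p zero ≈ pow y p
      first = trans (×-homo-1 _) (trans (*-identityˡ _) (sym (pow≈^ y p)))
      last : binomialTerm x y p (fromℕ p) ≈ pow x p
      last = begin
        (p C toℕ (fromℕ p)) · (x ^ʳ toℕ (fromℕ p) * y ^ʳ (p ℕ.∸ toℕ (fromℕ p)))
          ≈⟨ reflexive (≡.cong (λ k → (p C k) · (x ^ʳ k * y ^ʳ (p ℕ.∸ k))) (Fin.toℕ-fromℕ p)) ⟩
        (p C p) · (x ^ʳ p * y ^ʳ (p ℕ.∸ p))
          ≈⟨ ×-cong (nCn≡1 p) (*-congˡ (reflexive (≡.cong (y ^ʳ_) (ℕ.n∸n≡0 p)))) ⟩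
        1 · (x ^ʳ p * 1#)
          ≈⟨ trans (×-homo-1 _) (*-identityʳ _) ⟩
        x ^ʳ p
          ≈⟨ sym (pow≈^ x p) ⟩
        pow x p ∎

    pow-pᵏ-+ : ∀ k x y → pow (x + y) (p ℕ.^ k) ≈ pow x (p ℕ.^ k) + pow y (p ℕ.^ k)
    pow-pᵏ-+ zero    x y = trans (*-identityʳ _) (+-cong (sym (*-identityʳ _)) (sym (*-identityʳ _)))
    pow-pᵏ-+ (suc k) x y = begin
      pow (x + y) (p ℕ.* p ℕ.^ k)                         ≈⟨ pow-* (x + y) p (p ℕ.^ k) ⟩
      pow (pow (x + y) p) (p ℕ.^ k)                       ≈⟨ pow-cong (p ℕ.^ k) (freshman x y) ⟩
      pow (pow x p + pow y p) (p ℕ.^ k)                   ≈⟨ pow-pᵏ-+ k _ _ ⟩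
      pow (pow x p) (p ℕ.^ k) + pow (pow y p) (p ℕ.^ k)   ≈⟨ sym (+-cong (pow-* x p (p ℕ.^ k)) (pow-* y p (p ℕ.^ k))) ⟩
      pow x (p ℕ.* p ℕ.^ k) + pow y (p ℕ.* p ℕ.^ k)       ∎

module FiniteField {c ℓ} (R : CommutativeRing c ℓ) {N : ℕ} (finite : FieldDefs.IsFiniteFieldOfOrder R N) where
  open CommutativeRing R hiding (zero)
  open FieldDefs R
  open RingLemmas R
  open Characteristic R
  open IntegerCoefficientSolver R using (solve; _:+_; :-_; _:=_)
  open import Algebra.Properties.Semiring.Mult semiring renaming (_×_ to _·_)
  open import Algebra.Properties.CommutativeMonoid.Sum +-commutativeMonoid using (∑-permute; sum-replicate)
  open import Algebra.Definitions.RawMonoid +-rawMonoid using (sum)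
  open import Data.Fin.Permutation using (Permutation; permutation)
  open import Relation.Binary.Reasoning.Setoid setoid

  isField : IsField
  isField = proj₁ finite

  enum : Fin N → Carrier
  enum = proj₁ (proj₂ finite)

  enum-injective : ∀ i j → enum i ≈ enum j → i ≡ j
  enum-injective = proj₁ (proj₂ (proj₂ finite))

  index : Carrier → Fin N
  index x = proj₁ (proj₂ (proj₂ (proj₂ finite)) x)

  enum-index : ∀ x → enum (index x) ≈ x
  enum-index x = proj₂ (proj₂ (proj₂ (proj₂ finite)) x)

  _≟_ : Decidable _≈_
  x ≟ y with index x Fin.≟ index y
  ... | yes ix≡iy = yes (trans (sym (enum-index x)) (trans (reflexive (≡.cong enum ix≡iy)) (enum-index y)))
  ... | no  ix≢iy = no (λ x≈y → ix≢iy (enum-injective _ _ (trans (enum-index x) (trans x≈y (sym (enum-index y))))))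

  translate : Carrier → Fin N → Fin N
  translate a i = index (a + enum i)

  translate-inverse : ∀ a b → a + b ≈ 0# → ∀ i → translate a (translate b i) ≡ i
  translate-inverse a b a+b≈0 i = enum-injective _ _ (begin
    enum (index (a + enum (index (b + enum i))))  ≈⟨ enum-index _ ⟩
    a + enum (index (b + enum i))                 ≈⟨ +-congˡ (enum-index _) ⟩
    a + (b + enum i)                              ≈⟨ sym (+-assoc a b _) ⟩
    (a + b) + enum i                              ≈⟨ +-congʳ a+b≈0 ⟩
    0# + enum i                                   ≈⟨ +-identityˡ _ ⟩
    enum i                                        ∎)

  -- Translation by 1 permutes the field, so the sum S of all its elements satisfies S ≈ N · 1# + S.
  N·1≈0 : N · 1# ≈ 0#
  N·1≈0 = begin
    N · 1#               ≈⟨ solve 2 (λ a s → a := (a :+ s) :+ (:- s)) refl (N · 1#) S ⟩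
    (N · 1# + S) - S     ≈⟨ +-congʳ (sym S≈N·1+S) ⟩
    S - S                ≈⟨ -‿inverseʳ S ⟩
    0#                   ∎
    where
    S = ∑ N enum
    shift : Permutation N N
    shift = permutation (translate 1#) (translate (- 1#))
      (translate-inverse 1# (- 1#) (-‿inverseʳ 1#)) (translate-inverse (- 1#) 1# (-‿inverseˡ 1#))
    S≈N·1+S : S ≈ N · 1# + S
    S≈N·1+S = begin
      ∑ N enum                           ≈⟨ sym (sum≈∑ N enum) ⟩
      sum enum                           ≈⟨ ∑-permute enum shift ⟩
      sum (enum ∘ translate 1#)          ≈⟨ sum≈∑ N _ ⟩
      ∑ N (enum ∘ translate 1#)          ≈⟨ ∑-cong N (λ i → enum-index _) ⟩
      ∑ N (λ i → 1# + enum i)            ≈⟨ ∑-distrib-+ N _ _ ⟩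
      ∑ N (λ _ → 1#) + S                 ≈⟨ +-congʳ (trans (sym (sum≈∑ N _)) (sum-replicate N)) ⟩
      N · 1# + S                         ∎

  open FieldLemmas R isField _≟_ using (pow≈0⇒x≈0)

  characteristic : ∀ {p m} → N ≡ p ℕ.^ m → p · 1# ≈ 0#
  characteristic {p} {m} N≡pᵐ = pow≈0⇒x≈0 m (begin
    pow (p · 1#) m      ≈⟨ sym (pⁿ·1≈[p·1]ⁿ p m) ⟩
    (p ℕ.^ m) · 1#      ≡⟨ ≡.cong (_· 1#) (≡.sym N≡pᵐ) ⟩
    N · 1#              ≈⟨ N·1≈0 ⟩
    0#                  ∎)

  frobenius : ∀ {p m} → Prime p → N ≡ p ℕ.^ m → ∀ k → IsInjectiveHom (λ x → pow x (p ℕ.^ k))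
  frobenius {p} {m} p-prime N≡pᵐ k = record
    { cong    = pow-cong (p ℕ.^ k)
    ; +-homo  = pow-pᵏ-+ p-prime (characteristic {p} {m} N≡pᵐ) k
    ; *-homo  = λ x y → pow-distrib-* x y (p ℕ.^ k)
    ; kernel  = λ x → pow≈0⇒x≈0 (p ℕ.^ k)
    }

module LinearAlgebra {c ℓ} (R : CommutativeRing c ℓ) (isField : FieldDefs.IsField R)
                     (_≟_ : Decidable (CommutativeRing._≈_ R)) where
  open CommutativeRing R hiding (zero)
  open import Algebra.Properties.Ring ring using (-‿distribˡ-*; -1*x≈-x)
  open FieldDefs R
  open RingLemmas R
  open FieldLemmas R isField _≟_
  open IntegerCoefficientSolver R using (solve; _:+_; _:*_; _:-_; :-_; _:=_; con)
  open import Relation.Binary.Reasoning.Setoid setoid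

  ⟪_,_⟫ : ∀ {n} → Vect n → Vect n → Carrier
  ⟪_,_⟫ {n} γ v = ∑ n (λ j → γ j * v j)

  ⟪⟫-congʳ : ∀ {n} (γ : Vect n) {v w : Vect n} → (∀ j → v j ≈ w j) → ⟪ γ , v ⟫ ≈ ⟪ γ , w ⟫
  ⟪⟫-congʳ {n} γ v≈w = ∑-cong n (λ j → *-congˡ (v≈w j))

  ⟪⟫-linearʳ : ∀ {n} (γ v w : Vect n) a b → ⟪ γ , (λ j → a * v j + b * w j) ⟫ ≈ a * ⟪ γ , v ⟫ + b * ⟪ γ , w ⟫
  ⟪⟫-linearʳ {n} γ v w a b = begin
    ∑ n (λ j → γ j * (a * v j + b * w j))
      ≈⟨ ∑-cong n (λ j → solve 5 (λ g a v b w → g :* (a :* v :+ b :* w) := a :* (g :* v) :+ b :* (g :* w))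
          refl (γ j) a (v j) b (w j)) ⟩
    ∑ n (λ j → a * (γ j * v j) + b * (γ j * w j))
      ≈⟨ ∑-distrib-+ n _ _ ⟩
    ∑ n (λ j → a * (γ j * v j)) + ∑ n (λ j → b * (γ j * w j))
      ≈⟨ +-cong (∑-distribˡ-* n a _) (∑-distribˡ-* n b _) ⟩
    a * ⟪ γ , v ⟫ + b * ⟪ γ , w ⟫ ∎

  ⟪⟫-+ˡ : ∀ {n} (γ δ v : Vect n) → ⟪ (λ j → γ j + δ j) , v ⟫ ≈ ⟪ γ , v ⟫ + ⟪ δ , v ⟫
  ⟪⟫-+ˡ {n} γ δ v = trans (∑-cong n (λ j → distribʳ (v j) (γ j) (δ j))) (∑-distrib-+ n _ _)

  unit : ∀ {n} → Fin n → Vect n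
  unit r j with j Fin.≟ r
  ... | yes _ = 1#
  ... | no  _ = 0#

  ⟪scaled-unit⟫ : ∀ {n} a (r : Fin n) (v : Vect n) → ⟪ (λ j → a * unit r j) , v ⟫ ≈ a * v r
  ⟪scaled-unit⟫ {n} a r v = trans (∑-single n r off-r) at-r
    where
    off-r : ∀ j → j ≢ r → a * unit r j * v j ≈ 0#
    off-r j j≢r with j Fin.≟ r
    ... | yes j≡r = ⊥-elim (j≢r j≡r)
    ... | no  _   = trans (*-congʳ (zeroʳ a)) (zeroˡ _)
    at-r : a * unit r r * v r ≈ a * v r
    at-r with r Fin.≟ r
    ... | yes _   = *-congʳ (*-identityʳ a)
    ... | no  r≢r = ⊥-elim (r≢r ≡.refl)

  comb₂ : ∀ {n} → Carrier → Fin n → Carrier → Fin n → Vect n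
  comb₂ a r b s j = a * unit r j + b * unit s j

  ⟪comb₂⟫ : ∀ {n} a r b s (v : Vect n) → ⟪ comb₂ a r b s , v ⟫ ≈ a * v r + b * v s
  ⟪comb₂⟫ a r b s v = trans (⟪⟫-+ˡ _ _ v) (+-cong (⟪scaled-unit⟫ a r v) (⟪scaled-unit⟫ b s v))

  comb₃ : ∀ {n} → Carrier → Fin n → Carrier → Fin n → Carrier → Fin n → Vect n
  comb₃ a r b s e t j = comb₂ a r b s j + e * unit t j

  ⟪comb₃⟫ : ∀ {n} a r b s e t (v : Vect n) → ⟪ comb₃ a r b s e t , v ⟫ ≈ a * v r + b * v s + e * v t
  ⟪comb₃⟫ a r b s e t v = trans (⟪⟫-+ˡ _ _ v) (+-cong (⟪comb₂⟫ a r b s v) (⟪scaled-unit⟫ e t v))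

  minor : ∀ {n} → Vect n → Vect n → Fin n → Fin n → Carrier
  minor v w r s = det (v r) (v s) (w r) (w s)

  minor-self : ∀ {n} (w : Vect n) r s → minor w w r s ≈ 0#
  minor-self w r s = solve 2 (λ a b → a :* b :- b :* a := con (ℤ.+ 0)) refl (w r) (w s)

  minorForm : ∀ {n} → Vect n → Fin n → Fin n → Vect n
  minorForm w r s = comb₂ (w s) r (- w r) s

  ⟪minorForm⟫ : ∀ {n} (w : Vect n) r s (v : Vect n) → ⟪ minorForm w r s , v ⟫ ≈ minor v w r s
  ⟪minorForm⟫ w r s v = trans (⟪comb₂⟫ _ r _ s v)
    (solve 4 (λ ws wr vr vs → ws :* vr :+ (:- wr) :* vs := vr :* ws :- vs :* wr) refl (w s) (w r) (v r) (v s))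

  SamePoint-of-minors : ∀ {n} (v w : Vect n) r → v r ≉ 0# → (∀ s → minor v w r s ≈ 0#) → SamePoint v w
  SamePoint-of-minors v w r vr≉0 minors≈0 =
    w r * v r ⁻¹[ vr≉0 ] , λ j → *-solveˡ vr≉0 (trans (x-y≈0⇒x≈y (minors≈0 j)) (*-comm (v j) (w r)))

  minor≉0-of-distinct : ∀ {n} (v w : Vect n) → NonZero v → ¬ SamePoint v w →
                        ∃ λ r → ∃ λ s → minor v w r s ≉ 0#
  minor≉0-of-distinct {n} v w v≉0 v≁w with Fin.all? (λ r → Fin.all? (λ s → minor v w r s ≟ 0#))
  ... | yes minors≈0 = ⊥-elim (v≁w (SamePoint-of-minors v w r vr≉0 (minors≈0 r)))
    where
    r = proj₁ (nonzero-term v v≉0)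
    vr≉0 = proj₂ (nonzero-term v v≉0)
  ... | no ¬minors≈0 with Fin.¬∀⟶∃¬ n _ (λ r → Fin.all? (λ s → minor v w r s ≟ 0#)) ¬minors≈0
  ...   | r , ¬row≈0 with Fin.¬∀⟶∃¬ n _ (λ s → minor v w r s ≟ 0#) ¬row≈0
  ...     | s , minor≉0 = r , s , minor≉0

  planeForm : ∀ {n} → Vect n → Vect n → Fin n → Fin n → Fin n → Vect n
  planeForm v w r s t = comb₃ (minor v w s t) r (- minor v w r t) s (minor v w r s) t

  ⟪planeForm⟫ : ∀ {n} (v w x : Vect n) r s t →
    ⟪ planeForm v w r s t , x ⟫ ≈ (v s * w t - v t * w s) * x r - (v r * w t - v t * w r) * x s + (v r * w s - v s * w r) * x t
  ⟪planeForm⟫ v w x r s t = trans (⟪comb₃⟫ _ r _ s _ t x)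
    (+-congʳ (+-congˡ (sym (-‿distribˡ-* _ _))))

  planeForm-left : ∀ {n} (v w : Vect n) r s t → ⟪ planeForm v w r s t , v ⟫ ≈ 0#
  planeForm-left v w r s t = trans (⟪planeForm⟫ v w v r s t)
    (solve 6 (λ vr vs vt wr ws wt → (vs :* wt :- vt :* ws) :* vr :- (vr :* wt :- vt :* wr) :* vs :+ (vr :* ws :- vs :* wr) :* vt
              := con (ℤ.+ 0))
      refl (v r) (v s) (v t) (w r) (w s) (w t))

  planeForm-right : ∀ {n} (v w : Vect n) r s t → ⟪ planeForm v w r s t , w ⟫ ≈ 0#
  planeForm-right v w r s t = trans (⟪planeForm⟫ v w w r s t)
    (solve 6 (λ vr vs vt wr ws wt → (vs :* wt :- vt :* ws) :* wr :- (vr :* wt :- vt :* wr) :* ws :+ (vr :* ws :- vs :* wr) :* wt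
              := con (ℤ.+ 0))
      refl (v r) (v s) (v t) (w r) (w s) (w t))

  InSpan : ∀ {n} → Vect n → Vect n → Vect n → Set (c ⊔ ℓ)
  InSpan x v w = ∃ λ α → ∃ λ β → ∀ t → x t ≈ α * v t + β * w t

  InSpan-of-scaled : ∀ {n} {x v w : Vect n} {m} a b → m ≉ 0# → (∀ t → m * x t ≈ a * v t + b * w t) → InSpan x v w
  InSpan-of-scaled {x = x} {v} {w} {m} a b m≉0 mx≈ = a * m⁻¹ , b * m⁻¹ , λ t → *-cancelˡ m≉0 (begin
    m * x t
      ≈⟨ mx≈ t ⟩
    a * v t + b * w t
      ≈⟨ sym (trans (*-congˡ (*-inverseʳ m m≉0)) (*-identityʳ _)) ⟩
    (a * v t + b * w t) * (m * m⁻¹)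
      ≈⟨ solve 6 (λ a b vt wt m i → (a :* vt :+ b :* wt) :* (m :* i) := m :* (a :* i :* vt :+ b :* i :* wt))
          refl a b (v t) (w t) m m⁻¹ ⟩
    m * (a * m⁻¹ * v t + b * m⁻¹ * w t) ∎)
    where m⁻¹ = m ⁻¹[ m≉0 ]

  InSpan-of-planeForms : ∀ {n} (v w x : Vect n) r s → minor v w r s ≉ 0# →
                         (∀ t → ⟪ planeForm v w r s t , x ⟫ ≈ 0#) → InSpan x v w
  InSpan-of-planeForms v w x r s m≉0 forms≈0 = InSpan-of-scaled (minor x w r s) (minor v x r s) m≉0 λ t → begin
    minor v w r s * x t
      ≈⟨ solve 9 (λ vr vs vt wr ws wt xr xs xt →
           (vr :* ws :- vs :* wr) :* xt
           := (xr :* ws :- xs :* wr) :* vt :+ (vr :* xs :- vs :* xr) :* wt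
              :+ ((vs :* wt :- vt :* ws) :* xr :- (vr :* wt :- vt :* wr) :* xs :+ (vr :* ws :- vs :* wr) :* xt))
         refl (v r) (v s) (v t) (w r) (w s) (w t) (x r) (x s) (x t) ⟩
    minor x w r s * v t + minor v x r s * w t + _
      ≈⟨ +-congˡ (trans (sym (⟪planeForm⟫ v w x r s t)) (forms≈0 t)) ⟩
    minor x w r s * v t + minor v x r s * w t + 0#
      ≈⟨ +-identityʳ _ ⟩
    minor x w r s * v t + minor v x r s * w t ∎

  InSpan-exchange : ∀ {n} {x a b k : Vect n} γ δ → δ ≉ 0# → (∀ t → x t ≈ γ * a t + δ * k t) →
                    InSpan x a b → InSpan k a b
  InSpan-exchange {x = x} {a} {b} {k} γ δ δ≉0 x≈ (α , β , x≈αa+βb) = InSpan-of-scaled (α - γ) β δ≉0 λ t → begin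
    δ * k t
      ≈⟨ solve 3 (λ g a x → x := (g :* a :+ x) :- g :* a) refl γ (a t) (δ * k t) ⟩
    (γ * a t + δ * k t) - γ * a t
      ≈⟨ +-congʳ (trans (sym (x≈ t)) (x≈αa+βb t)) ⟩
    (α * a t + β * b t) - γ * a t
      ≈⟨ solve 5 (λ α β γ a b → α :* a :+ β :* b :- γ :* a := (α :- γ) :* a :+ β :* b) refl α β γ (a t) (b t) ⟩
    (α - γ) * a t + β * b t ∎

  Indep₂-of-distinct : ∀ {n} (a b : Vect n) → NonZero a → ¬ SamePoint a b → Indep₂ a b
  Indep₂-of-distinct a b a≉0 a≁b x y xa+yb≈0 with y ≟ 0#
  ... | no y≉0 = ⊥-elim (a≁b (- x * y ⁻¹[ y≉0 ] , λ t → *-solveˡ y≉0 (begin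
        y * b t                             ≈⟨ solve 3 (λ x a yb → yb := (x :* a :+ yb) :- x :* a) refl x (a t) (y * b t) ⟩
        (x * a t + y * b t) - x * a t       ≈⟨ +-congʳ (xa+yb≈0 t) ⟩
        0# - x * a t                        ≈⟨ solve 2 (λ x a → con (ℤ.+ 0) :- x :* a := (:- x) :* a) refl x (a t) ⟩
        - x * a t                           ∎)))
  ... | yes y≈0 = x*y≈0⇒y≈0 ar≉0 (trans (*-comm _ _) (begin
        x * a r                ≈⟨ sym (+-identityʳ _) ⟩
        x * a r + 0#           ≈⟨ +-congˡ (sym (trans (*-congʳ y≈0) (zeroˡ _))) ⟩
        x * a r + y * b r      ≈⟨ xa+yb≈0 r ⟩
        0#                     ∎)) , y≈0
    where
    r = proj₁ (nonzero-term a a≉0)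
    ar≉0 = proj₂ (nonzero-term a a≉0)

  Indep₂⇒NonZero : ∀ {n} {a b : Vect n} → Indep₂ a b → NonZero a
  Indep₂⇒NonZero {a = a} {b} a⊥b a≈0 = 1≉0 (proj₁ (a⊥b 1# 0# λ j →
    trans (+-cong (trans (*-congˡ (a≈0 j)) (zeroʳ _)) (zeroˡ _)) (+-identityˡ 0#)))

  Indep₂⇒distinct : ∀ {n} {a b : Vect n} → Indep₂ a b → ¬ SamePoint a b
  Indep₂⇒distinct {a = a} {b} a⊥b (k , b≈ka) = 1≉0 (-x≈0⇒x≈0 (proj₂ (a⊥b k (- 1#) λ j → begin
    k * a j + - 1# * b j         ≈⟨ +-congˡ (*-congˡ (b≈ka j)) ⟩
    k * a j + - 1# * (k * a j)   ≈⟨ +-congˡ (-1*x≈-x _) ⟩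
    k * a j - k * a j            ≈⟨ -‿inverseʳ _ ⟩
    0#                           ∎)))

  dual-pair : ∀ {n} {a b : Vect n} → Indep₂ a b → ∀ A B → ∃ λ γ → (⟪ γ , a ⟫ ≈ A) × (⟪ γ , b ⟫ ≈ B)
  dual-pair {a = a} {b} a⊥b A B = comb₂ λ′ r μ′ s , on-a , on-b
    where
    minor≉0 = minor≉0-of-distinct a b (Indep₂⇒NonZero a⊥b) (Indep₂⇒distinct a⊥b)
    r = proj₁ minor≉0
    s = proj₁ (proj₂ minor≉0)
    m≉0 = proj₂ (proj₂ minor≉0)
    m⁻¹ = minor a b r s ⁻¹[ m≉0 ]
    λ′ = (A * b s - B * a s) * m⁻¹
    μ′ = (B * a r - A * b r) * m⁻¹
    on-a : ⟪ comb₂ λ′ r μ′ s , a ⟫ ≈ A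
    on-a = begin
      ⟪ comb₂ λ′ r μ′ s , a ⟫
        ≈⟨ ⟪comb₂⟫ λ′ r μ′ s a ⟩
      λ′ * a r + μ′ * a s
        ≈⟨ solve 7 (λ A B ar as br bs i → (A :* bs :- B :* as) :* i :* ar :+ (B :* ar :- A :* br) :* i :* as
                                                               := A :* ((ar :* bs :- as :* br) :* i))
                                                                   refl A B (a r) (a s) (b r) (b s) m⁻¹ ⟩
      A * (minor a b r s * m⁻¹)
        ≈⟨ *-congˡ (*-inverseʳ _ m≉0) ⟩
      A * 1#
        ≈⟨ *-identityʳ A ⟩
      A ∎
    on-b : ⟪ comb₂ λ′ r μ′ s , b ⟫ ≈ B
    on-b = begin
      ⟪ comb₂ λ′ r μ′ s , b ⟫
        ≈⟨ ⟪comb₂⟫ λ′ r μ′ s b ⟩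
      λ′ * b r + μ′ * b s
        ≈⟨ solve 7 (λ A B ar as br bs i → (A :* bs :- B :* as) :* i :* br :+ (B :* ar :- A :* br) :* i :* bs
                                                               := B :* ((ar :* bs :- as :* br) :* i))
                                                                   refl A B (a r) (a s) (b r) (b s) m⁻¹ ⟩
      B * (minor a b r s * m⁻¹)
        ≈⟨ *-congˡ (*-inverseʳ _ m≉0) ⟩
      B * 1#
        ≈⟨ *-identityʳ B ⟩
      B ∎

  InSpan-left : ∀ {n} (v w : Vect n) → InSpan v v w
  InSpan-left v w = 1# , 0# , λ t → sym (trans (+-cong (*-identityˡ _) (zeroˡ _)) (+-identityʳ _))

  InSpan-right : ∀ {n} (v w : Vect n) → InSpan w v w
  InSpan-right v w = 0# , 1# , λ t → sym (trans (+-cong (zeroˡ _) (*-identityˡ _)) (+-identityˡ _))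

module _ {m : ℕ} where
  transpose-left : (i j : Fin m) → transpose i j i ≡ j
  transpose-left i j with i Fin.≟ i
  ... | yes _   = ≡.refl
  ... | no  i≢i = ⊥-elim (i≢i ≡.refl)

  transpose-right : (i j : Fin m) → transpose i j j ≡ i
  transpose-right i j with j Fin.≟ i
  ... | yes j≡i = j≡i
  ... | no  _ with j Fin.≟ j
  ...   | yes _   = ≡.refl
  ...   | no  j≢j = ⊥-elim (j≢j ≡.refl)

  transpose-other : (i j k : Fin m) → k ≢ i → k ≢ j → transpose i j k ≡ k
  transpose-other i j k k≢i k≢j with k Fin.≟ i
  ... | yes k≡i = ⊥-elim (k≢i k≡i)
  ... | no  _ with k Fin.≟ j
  ...   | yes k≡j = ⊥-elim (k≢j k≡j)
  ...   | no  _   = ≡.refl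

  placing : ∀ {x y a b : Fin m} → x ≢ y → a ≢ b →
            Σ (Fin m → Fin m) λ π → (π x ≡ a) × (π y ≡ b) × (∀ z → ∃ λ w → π w ≡ z)
  placing {x} {y} {a} {b} x≢y a≢b =
    transpose x a ∘ transpose y b′ , πx≡a , πy≡b ,
    λ z → transpose b′ y (transpose a x z) ,
          ≡.trans (≡.cong (transpose x a) (transpose-inverse y b′ {transpose a x z})) (transpose-inverse x a {z})
    where
    b′ = transpose a x b
    x≢b′ : x ≢ b′
    x≢b′ x≡b′ = a≢b (≡.trans (≡.sym (transpose-left x a))
                       (≡.trans (≡.cong (transpose x a) x≡b′) (transpose-inverse x a {b})))
    πx≡a : transpose x a (transpose y b′ x) ≡ a
    πx≡a = ≡.trans (≡.cong (transpose x a) (transpose-other y b′ x x≢y x≢b′)) (transpose-left x a)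
    πy≡b : transpose x a (transpose y b′ y) ≡ b
    πy≡b = ≡.trans (≡.cong (transpose x a) (transpose-left y b′)) (transpose-inverse x a {b})

module Complement {d} {k l : Fin (suc (suc d))} (k≢l : k ≢ l) where
  others : Fin d → Fin (suc (suc d))
  others x = punchIn k (punchIn (punchOut k≢l) x)

  others≢left : ∀ x → others x ≢ k
  others≢left x = Fin.punchInᵢ≢i k _

  others≢right : ∀ x → others x ≢ l
  others≢right x eq = Fin.punchInᵢ≢i (punchOut k≢l) x
    (Fin.punchIn-injective k _ _ (≡.trans eq (≡.sym (Fin.punchIn-punchOut k≢l))))

  others-injective : ∀ {x y} → others x ≡ others y → x ≡ y
  others-injective = Fin.punchIn-injective (punchOut k≢l) _ _ ∘ Fin.punchIn-injective k _ _

  others-surjective : ∀ y → y ≢ k → y ≢ l → ∃ λ x → others x ≡ y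
  others-surjective y y≢k y≢l =
    punchOut y′≢l′ , ≡.trans (≡.cong (punchIn k) (Fin.punchIn-punchOut y′≢l′)) (Fin.punchIn-punchOut k≢y)
    where
    k≢y : k ≢ y
    k≢y = y≢k ∘ ≡.sym
    y′≢l′ : punchOut k≢l ≢ punchOut k≢y
    y′≢l′ eq = y≢l (≡.trans (≡.sym (Fin.punchIn-punchOut k≢y))
                     (≡.trans (≡.cong (punchIn k) (≡.sym eq)) (Fin.punchIn-punchOut k≢l)))

  placing-others : ∀ {β₁ β₂ : Fin d} {i j} → β₁ ≢ β₂ → i ≢ j → i ≢ k → i ≢ l → j ≢ k → j ≢ l →
    Σ (Fin d → Fin (suc (suc d))) λ slot → (slot β₁ ≡ i) × (slot β₂ ≡ j) ×
      (∀ β → slot β ≢ k) × (∀ β → slot β ≢ l) × (∀ y → y ≢ k → y ≢ l → ∃ λ w → slot w ≡ y)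
  placing-others {i = i} {j} β₁≢β₂ i≢j i≢k i≢l j≢k j≢l =
    others ∘ π ,
    ≡.trans (≡.cong others πβ₁≡x) (proj₂ pre-i) ,
    ≡.trans (≡.cong others πβ₂≡y) (proj₂ pre-j) ,
    others≢left ∘ π ,
    others≢right ∘ π ,
    λ z z≢k z≢l → proj₁ (π-onto (proj₁ (others-surjective z z≢k z≢l))) ,
      ≡.trans (≡.cong others (proj₂ (π-onto _))) (proj₂ (others-surjective z z≢k z≢l))
    where
    pre-i = others-surjective i i≢k i≢l
    pre-j = others-surjective j j≢k j≢l
    x≢y : proj₁ pre-i ≢ proj₁ pre-j
    x≢y x≡y = i≢j (≡.trans (≡.sym (proj₂ pre-i)) (≡.trans (≡.cong others x≡y) (proj₂ pre-j)))
    placed = placing β₁≢β₂ x≢y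
    π = proj₁ placed
    πβ₁≡x = proj₁ (proj₂ placed)
    πβ₂≡y = proj₁ (proj₂ (proj₂ placed))
    π-onto = proj₂ (proj₂ (proj₂ placed))

module DependentImages {c ℓ} (R : CommutativeRing c ℓ) (isField : FieldDefs.IsField R)
                       (_≟_ : Decidable (CommutativeRing._≈_ R)) where
  open CommutativeRing R hiding (zero)
  open import Algebra.Properties.Ring ring using (-0#≈0#)
  open FieldDefs R
  open RingLemmas R
  open FieldLemmas R isField _≟_
  open LinearAlgebra R isField _≟_
  open IntegerCoefficientSolver R using (solve; _:+_; _:*_; _:-_; :-_; _:=_; con)
  open import Relation.Binary.Reasoning.Setoid setoid

  module Functionals {n d K : ℕ} (σ : Fin d → Carrier → Carrier) (σ-hom : ∀ i → IsInjectiveHom (σ i))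
    (coeff : Fin K → Carrier) (P : Fin K → Vect n)
    (dependent : ∀ (J : Fin d → Fin n) → ∑ K (λ k → coeff k * ∏ d (λ i → σ i (P k (J i)))) ≈ 0#) where
    module σ i = IsInjectiveHom (σ-hom i)

    value : (Fin d → Vect n) → Fin K → Carrier
    value γ k = ∏ d (λ i → σ i ⟪ γ i , P k ⟫)

    value-expansion : ∀ γ k →
      value γ k ≈ ∑ᶠ d (λ J → ∏ d (λ i → σ i (γ i (J i))) * ∏ d (λ i → σ i (P k (J i))))
    value-expansion γ k = begin
      ∏ d (λ i → σ i ⟪ γ i , P k ⟫)
        ≈⟨ ∏-cong d (λ i → trans (σ.∑-homo i n _) (∑-cong n (λ j → σ.*-homo i _ _))) ⟩
      ∏ d (λ i → ∑ n (λ j → σ i (γ i j) * σ i (P k j)))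
        ≈⟨ ∏-∑-distrib d _ ⟩
      ∑ᶠ d (λ J → ∏ d (λ i → σ i (γ i (J i)) * σ i (P k (J i))))
        ≈⟨ ∑ᶠ-cong d (λ J → ∏-distrib-* d _ _) ⟩
      ∑ᶠ d (λ J → ∏ d (λ i → σ i (γ i (J i))) * ∏ d (λ i → σ i (P k (J i)))) ∎

    ∑-coeff*value : ∀ γ → ∑ K (λ k → coeff k * value γ k) ≈ 0#
    ∑-coeff*value γ = begin
      ∑ K (λ k → coeff k * value γ k)
        ≈⟨ ∑-cong K (λ k → trans (*-congˡ (value-expansion γ k)) (sym (∑ᶠ-distribˡ-* d _ _))) ⟩
      ∑ K (λ k → ∑ᶠ d (λ J → coeff k * (Γ J * T k J)))
        ≈⟨ ∑-∑ᶠ-comm d K _ ⟩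
      ∑ᶠ d (λ J → ∑ K (λ k → coeff k * (Γ J * T k J)))
        ≈⟨ ∑ᶠ-cong d (λ J → trans (∑-cong K (λ k → solve 3 (λ c g t → c :* (g :* t) := g :* (c :* t)) refl _ _ _))
                                  (∑-distribˡ-* K (Γ J) _)) ⟩
      ∑ᶠ d (λ J → Γ J * ∑ K (λ k → coeff k * T k J))
        ≈⟨ ∑ᶠ-zero d (λ J → trans (*-congˡ (dependent J)) (zeroʳ _)) ⟩
      0# ∎
      where
      Γ : (Fin d → Fin n) → Carrier
      Γ J = ∏ d (λ i → σ i (γ i (J i)))
      T : Fin K → (Fin d → Fin n) → Carrier
      T k J = ∏ d (λ i → σ i (P k (J i)))

    Kills : (Fin d → Vect n) → Fin K → Set ℓ
    Kills γ k = ∃ λ i → ⟪ γ i , P k ⟫ ≈ 0#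

    value-killed : ∀ γ k → Kills γ k → value γ k ≈ 0#
    value-killed γ k (i , γᵢPₖ≈0) = ∏-zero d i (trans (σ.cong i γᵢPₖ≈0) (σ.0#-homo i))

    value-nonzero : ∀ γ k → (∀ i → ⟪ γ i , P k ⟫ ≉ 0#) → value γ k ≉ 0#
    value-nonzero γ k γP≉0 = ∏-nonzero d (λ i → σ.≉0-homo i (γP≉0 i))

    coeff≈0-of-isolated : ∀ γ r → (∀ k → k ≢ r → Kills γ k) → (∀ i → ⟪ γ i , P r ⟫ ≉ 0#) → coeff r ≈ 0#
    coeff≈0-of-isolated γ r kills γP≉0 = x*y≈0⇒y≈0 (value-nonzero γ r γP≉0) (begin
      value γ r * coeff r
        ≈⟨ *-comm _ _ ⟩
      coeff r * value γ r
        ≈⟨ sym (∑-single K r (λ k k≢r → trans (*-congˡ (value-killed γ k (kills k k≢r))) (zeroʳ _))) ⟩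
      ∑ K (λ k → coeff k * value γ k)
        ≈⟨ ∑-coeff*value γ ⟩
      0# ∎)

    coeff*value-pair : ∀ γ r s → r ≢ s → (∀ k → k ≢ r → k ≢ s → Kills γ k) →
                       coeff r * value γ r + coeff s * value γ s ≈ 0#
    coeff*value-pair γ r s r≢s kills = trans
      (sym (∑-pair K r s r≢s (λ k k≢r k≢s → trans (*-congˡ (value-killed γ k (kills k k≢r k≢s))) (zeroʳ _))))
      (∑-coeff*value γ)

  module Collinearity {n d₁ : ℕ} (σ : Fin (suc d₁) → Carrier → Carrier) (σ-hom : ∀ i → IsInjectiveHom (σ i))
    (coeff : Fin (suc (suc (suc d₁))) → Carrier) (P : Fin (suc (suc (suc d₁))) → Vect n)
    (dependent : ∀ (J : Fin (suc d₁) → Fin n) → ∑ (suc (suc (suc d₁))) (λ k → coeff k * ∏ (suc d₁) (λ i → σ i (P k (J i)))) ≈ 0#)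
    (P≉0 : ∀ k → NonZero (P k)) (distinct : ∀ k l → k ≢ l → ¬ SamePoint (P k) (P l))
    (coeff≢0 : ¬ (∀ k → coeff k ≈ 0#)) where
    open Functionals σ σ-hom coeff P dependent

    -- Slot 0 takes φ; each other slot takes a minor form vanishing on one of the d - 1 points
    -- outside {r, a, b} but not on P r.
    isolating : ∀ {r a b} → a ≢ b → r ≢ a → r ≢ b → (φ : Vect n) →
                ⟪ φ , P a ⟫ ≈ 0# → ⟪ φ , P b ⟫ ≈ 0# → ⟪ φ , P r ⟫ ≉ 0# →
                Σ (Fin (suc d₁) → Vect n) λ γ → (∀ k → k ≢ r → Kills γ k) × (∀ i → ⟪ γ i , P r ⟫ ≉ 0#)
    isolating {r} {a} {b} a≢b r≢a r≢b φ φPa≈0 φPb≈0 φPᵣ≉0 = γ , kills , γPᵣ≉0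
      where
      open Complement a≢b
      x₀ = proj₁ (others-surjective r r≢a r≢b)
      others-x₀≡r = proj₂ (others-surjective r r≢a r≢b)
      rest : Fin d₁ → Fin (suc (suc (suc d₁)))
      rest β = others (punchIn x₀ β)
      r≢rest : ∀ β → r ≢ rest β
      r≢rest β r≡rest = Fin.punchInᵢ≢i x₀ β (others-injective (≡.trans (≡.sym r≡rest) (≡.sym others-x₀≡r)))
      separating : ∀ β → ∃ λ ρ → ∃ λ s → minor (P r) (P (rest β)) ρ s ≉ 0#
      separating β = minor≉0-of-distinct (P r) (P (rest β)) (P≉0 r) (distinct r (rest β) (r≢rest β))
      γ : Fin (suc d₁) → Vect n
      γ zero    = φ
      γ (suc β) = minorForm (P (rest β)) (proj₁ (separating β)) (proj₁ (proj₂ (separating β)))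
      γPᵣ≉0 : ∀ i → ⟪ γ i , P r ⟫ ≉ 0#
      γPᵣ≉0 zero    = φPᵣ≉0
      γPᵣ≉0 (suc β) = proj₂ (proj₂ (separating β)) ∘ trans (sym (⟪minorForm⟫ (P (rest β)) _ _ (P r)))
      kills : ∀ k → k ≢ r → Kills γ k
      kills k k≢r with k Fin.≟ a | k Fin.≟ b
      ... | yes ≡.refl | _          = zero , φPa≈0
      ... | no _       | yes ≡.refl = zero , φPb≈0
      ... | no k≢a     | no k≢b     = suc β , ≡.subst (λ y → ⟪ γ (suc β) , P y ⟫ ≈ 0#) rest-β≡k
                                                (trans (⟪minorForm⟫ w _ _ w) (minor-self w _ _))
        where
        x = proj₁ (others-surjective k k≢a k≢b)
        x₀≢x : x₀ ≢ x
        x₀≢x x₀≡x = k≢r (≡.trans (≡.sym (proj₂ (others-surjective k k≢a k≢b)))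
                          (≡.trans (≡.cong others (≡.sym x₀≡x)) others-x₀≡r))
        β = punchOut x₀≢x
        w = P (rest β)
        rest-β≡k : rest β ≡ k
        rest-β≡k = ≡.trans (≡.cong others (Fin.punchIn-punchOut x₀≢x)) (proj₂ (others-surjective k k≢a k≢b))

    InSpan-of-coeff≉0 : ∀ r → coeff r ≉ 0# → ∀ a b → a ≢ b → r ≢ a → r ≢ b → InSpan (P r) (P a) (P b)
    InSpan-of-coeff≉0 r cᵣ≉0 a b a≢b r≢a r≢b = InSpan-of-planeForms (P a) (P b) (P r) ρ s m≉0 forms≈0
      where
      minor≉0 = minor≉0-of-distinct (P a) (P b) (P≉0 a) (distinct a b a≢b)
      ρ = proj₁ minor≉0
      s = proj₁ (proj₂ minor≉0)
      m≉0 = proj₂ (proj₂ minor≉0)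
      forms≈0 : ∀ t → ⟪ planeForm (P a) (P b) ρ s t , P r ⟫ ≈ 0#
      forms≈0 t with ⟪ planeForm (P a) (P b) ρ s t , P r ⟫ ≟ 0#
      ... | yes form≈0 = form≈0
      ... | no  form≉0 = ⊥-elim (cᵣ≉0 (coeff≈0-of-isolated γ r (proj₁ (proj₂ isolated)) (proj₂ (proj₂ isolated))))
        where
        isolated = isolating a≢b r≢a r≢b (planeForm (P a) (P b) ρ s t)
                     (planeForm-left (P a) (P b) ρ s t) (planeForm-right (P a) (P b) ρ s t) form≉0
        γ = proj₁ isolated

    private
      r : Fin (suc (suc (suc d₁)))
      r = proj₁ (nonzero-term coeff coeff≢0)
      cᵣ≉0 : coeff r ≉ 0#
      cᵣ≉0 = proj₂ (nonzero-term coeff coeff≢0)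

    a₀ b₀ : Fin (suc (suc (suc d₁)))
    a₀ = punchIn r zero
    b₀ = punchIn r (suc zero)

    r≢a₀ : r ≢ a₀
    r≢a₀ = Fin.punchInᵢ≢i r zero ∘ ≡.sym

    r≢b₀ : r ≢ b₀
    r≢b₀ = Fin.punchInᵢ≢i r (suc zero) ∘ ≡.sym

    a₀≢b₀ : a₀ ≢ b₀
    a₀≢b₀ a₀≡b₀ with Fin.punchIn-injective r zero (suc zero) a₀≡b₀
    ... | ()

    independent : Indep₂ (P a₀) (P b₀)
    independent = Indep₂-of-distinct (P a₀) (P b₀) (P≉0 a₀) (distinct a₀ b₀ a₀≢b₀)

    collinear : ∀ k → InSpan (P k) (P a₀) (P b₀)
    collinear k with k Fin.≟ a₀ | k Fin.≟ b₀ | k Fin.≟ r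
    ... | yes ≡.refl | _          | _          = InSpan-left (P a₀) (P b₀)
    ... | no _       | yes ≡.refl | _          = InSpan-right (P a₀) (P b₀)
    ... | no _       | no _       | yes ≡.refl = InSpan-of-coeff≉0 r cᵣ≉0 a₀ b₀ a₀≢b₀ r≢a₀ r≢b₀
    ... | no k≢a₀    | no k≢b₀    | no k≢r     =
      InSpan-exchange γ δ δ≉0 Pᵣ≈γa₀+δk (InSpan-of-coeff≉0 r cᵣ≉0 a₀ b₀ a₀≢b₀ r≢a₀ r≢b₀)
      where
      Pᵣ∈⟨a₀,k⟩ = InSpan-of-coeff≉0 r cᵣ≉0 a₀ k (k≢a₀ ∘ ≡.sym) r≢a₀ (k≢r ∘ ≡.sym)
      γ = proj₁ Pᵣ∈⟨a₀,k⟩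
      δ = proj₁ (proj₂ Pᵣ∈⟨a₀,k⟩)
      Pᵣ≈γa₀+δk = proj₂ (proj₂ Pᵣ∈⟨a₀,k⟩)
      δ≉0 : δ ≉ 0#
      δ≉0 δ≈0 = distinct a₀ r (r≢a₀ ∘ ≡.sym) (γ , λ t →
        trans (Pᵣ≈γa₀+δk t) (trans (+-congˡ (trans (*-congʳ δ≈0) (zeroˡ _))) (+-identityʳ _)))

  module LineCoordinates {n d₁ : ℕ} (σ : Fin (suc d₁) → Carrier → Carrier) (σ-hom : ∀ i → IsInjectiveHom (σ i))
    (coeff : Fin (suc (suc (suc d₁))) → Carrier) (P : Fin (suc (suc (suc d₁))) → Vect n)
    (dependent : ∀ (J : Fin (suc d₁) → Fin n) → ∑ (suc (suc (suc d₁))) (λ k → coeff k * ∏ (suc d₁) (λ i → σ i (P k (J i)))) ≈ 0#)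
    (P≉0 : ∀ k → NonZero (P k)) (distinct : ∀ k l → k ≢ l → ¬ SamePoint (P k) (P l))
    (coeff≢0 : ¬ (∀ k → coeff k ≈ 0#))
    (a b : Vect n) (a⊥b : Indep₂ a b)
    (α β : Fin (suc (suc (suc d₁))) → Carrier) (P≈αa+βb : ∀ k j → P k j ≈ α k * a j + β k * b j) where
    open Functionals σ σ-hom coeff P dependent

    Point : Set
    Point = Fin (suc (suc (suc d₁)))

    D : Point → Point → Carrier
    D x y = det (α x) (β x) (α y) (β y)

    D-self : ∀ x → D x x ≈ 0#
    D-self x = solve 2 (λ a b → a :* b :- b :* a := con (ℤ.+ 0)) refl (α x) (β x)

    D-antisym : ∀ x y → D x y ≈ - D y x
    D-antisym x y = det-antisym (α x) (β x) (α y) (β y)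

    coords≉0 : ∀ y → ¬ ((α y ≈ 0#) × (β y ≈ 0#))
    coords≉0 y (αy≈0 , βy≈0) = P≉0 y λ j → trans (P≈αa+βb y j)
      (trans (+-cong (trans (*-congʳ αy≈0) (zeroˡ _)) (trans (*-congʳ βy≈0) (zeroˡ _))) (+-identityˡ 0#))

    D≉0 : ∀ x y → x ≢ y → D x y ≉ 0#
    D≉0 x y x≢y Dxy≈0 = distinct y x (x≢y ∘ ≡.sym) (k , λ j → begin
        P x j
          ≈⟨ P≈αa+βb x j ⟩
        α x * a j + β x * b j
          ≈⟨ +-cong (*-congʳ αx≈kαy) (*-congʳ βx≈kβy) ⟩
        k * α y * a j + k * β y * b j
          ≈⟨ solve 5 (λ k α a β b → k :* α :* a :+ k :* β :* b := k :* (α :* a :+ β :* b)) refl k (α y) (a j) (β y) (b j) ⟩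
        k * (α y * a j + β y * b j)
          ≈⟨ *-congˡ (sym (P≈αa+βb y j)) ⟩
        k * P y j ∎)
      where
      proportional = det≈0⇒proportional (coords≉0 y) (trans (D-antisym y x) (trans (-‿cong Dxy≈0) -0#≈0#))
      k = proj₁ proportional
      αx≈kαy = proj₁ (proj₂ proportional)
      βx≈kβy = proj₂ (proj₂ proportional)

    dualForm : Point → Vect n
    dualForm m = proj₁ (dual-pair a⊥b (β m) (- α m))

    ⟪dualForm⟫ : ∀ m x → ⟪ dualForm m , P x ⟫ ≈ D x m
    ⟪dualForm⟫ m x = begin
      ⟪ dualForm m , P x ⟫
        ≈⟨ ⟪⟫-congʳ (dualForm m) (P≈αa+βb x) ⟩
      ⟪ dualForm m , (λ j → α x * a j + β x * b j) ⟫
        ≈⟨ ⟪⟫-linearʳ (dualForm m) a b (α x) (β x) ⟩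
      α x * ⟪ dualForm m , a ⟫ + β x * ⟪ dualForm m , b ⟫
        ≈⟨ +-cong (*-congˡ (proj₁ (proj₂ dual))) (*-congˡ (proj₂ (proj₂ dual))) ⟩
      α x * β m + β x * (- α m)
        ≈⟨ solve 4 (λ a b c d → a :* b :+ c :* (:- d) := a :* b :- c :* d) refl (α x) (β m) (β x) (α m) ⟩
      D x m ∎
      where dual = dual-pair a⊥b (β m) (- α m)

    dualForms-kill : ∀ (slot : Fin (suc d₁) → Point) y w → slot w ≡ y → Kills (dualForm ∘ slot) y
    dualForms-kill slot y w ≡.refl = w , trans (⟪dualForm⟫ y y) (D-self y)

    dualForms-value : ∀ (slot : Fin (suc d₁) → Point) x → value (dualForm ∘ slot) x ≈ ∏ (suc d₁) (λ β → σ β (D x (slot β)))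
    dualForms-value slot x = ∏-cong (suc d₁) (λ β → σ.cong β (⟪dualForm⟫ (slot β) x))

    dualForms-value≉0 : ∀ (slot : Fin (suc d₁) → Point) x → (∀ β → slot β ≢ x) → value (dualForm ∘ slot) x ≉ 0#
    dualForms-value≉0 slot x slot≢x = value-nonzero (dualForm ∘ slot) x λ β →
      D≉0 x (slot β) (slot≢x β ∘ ≡.sym) ∘ trans (sym (⟪dualForm⟫ (slot β) x))

    remaining : (Fin (suc d₁) → Point) → Fin (suc d₁) → Fin (suc d₁) → Point → Carrier
    remaining slot β₁ β₂ x = ∏ (suc d₁) (updateAt (updateAt (λ β → σ β (D x (slot β))) β₁ (λ _ → 1#)) β₂ (λ _ → 1#))

    dualForms-value₂ : ∀ (slot : Fin (suc d₁) → Point) x {β₁ β₂} → β₁ ≢ β₂ →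
      value (dualForm ∘ slot) x ≈ σ β₁ (D x (slot β₁)) * (σ β₂ (D x (slot β₂)) * remaining slot β₁ β₂ x)
    dualForms-value₂ slot x β₁≢β₂ = trans (dualForms-value slot x) (∏-updateAt₂ (suc d₁) _ β₁≢β₂)

    remaining-transpose : ∀ (slot : Fin (suc d₁) → Point) β₁ β₂ x →
                          remaining (slot ∘ transpose β₁ β₂) β₁ β₂ x ≈ remaining slot β₁ β₂ x
    remaining-transpose slot β₁ β₂ x = ∏-updateAt₂-cong (suc d₁) β₁ β₂ λ β β≢β₁ β≢β₂ →
      reflexive (≡.cong (λ y → σ β (D x (slot y))) (transpose-other β₁ β₂ β β≢β₁ β≢β₂))

    remaining≉0 : ∀ (slot : Fin (suc d₁) → Point) x {β₁ β₂} → β₁ ≢ β₂ → (∀ β → slot β ≢ x) →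
                  remaining slot β₁ β₂ x ≉ 0#
    remaining≉0 slot x β₁≢β₂ slot≢x remaining≈0 = dualForms-value≉0 slot x slot≢x
      (trans (dualForms-value₂ slot x β₁≢β₂) (trans (*-congˡ (trans (*-congˡ remaining≈0) (zeroʳ _))) (zeroʳ _)))

    private
      r₀ : Point
      r₀ = proj₁ (nonzero-term coeff coeff≢0)
      coeff-r₀≉0 : coeff r₀ ≉ 0#
      coeff-r₀≉0 = proj₂ (nonzero-term coeff coeff≢0)

    coeff≉0 : ∀ s → coeff s ≉ 0#
    coeff≉0 s with s Fin.≟ r₀
    ... | yes ≡.refl = coeff-r₀≉0
    ... | no  s≢r₀   = λ cₛ≈0 → dualForms-value≉0 others r₀ others≢left (x*y≈0⇒y≈0 coeff-r₀≉0 (begin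
        coeff r₀ * value γ r₀                        ≈⟨ sym (+-identityʳ _) ⟩
        coeff r₀ * value γ r₀ + 0#                   ≈⟨ +-congˡ (sym (trans (*-congʳ cₛ≈0) (zeroˡ _))) ⟩
        coeff r₀ * value γ r₀ + coeff s * value γ s  ≈⟨ coeff*value-pair γ r₀ s (s≢r₀ ∘ ≡.sym) kills ⟩
        0#                                           ∎))
      where
      open Complement (s≢r₀ ∘ ≡.sym)
      γ = dualForm ∘ others
      kills : ∀ k → k ≢ r₀ → k ≢ s → Kills γ k
      kills k k≢r₀ k≢s = dualForms-kill others k _ (proj₂ (others-surjective k k≢r₀ k≢s))

    -- Compare two families of dual forms vanishing on every point but k and l: they differ by
    -- exchanging, between the slots β₁ and β₂, the forms dual to i and j.
    cross : ∀ {i j k l} → i ≢ j → i ≢ k → i ≢ l → j ≢ k → j ≢ l → k ≢ l → ∀ {β₁ β₂} → β₁ ≢ β₂ →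
            σ β₁ (D k i * D l j) * σ β₂ (D k j * D l i) ≈ σ β₁ (D k j * D l i) * σ β₂ (D k i * D l j)
    cross {i} {j} {k} {l} i≢j i≢k i≢l j≢k j≢l k≢l {β₁} {β₂} β₁≢β₂ = *-cancelˡ (*-nonzero Rₖ≉0 Rₗ≉0) (begin
      Rₖ * Rₗ * (σ β₁ (D k i * D l j) * σ β₂ (D k j * D l i))
        ≈⟨ *-congˡ (*-cong (σ.*-homo β₁ _ _) (σ.*-homo β₂ _ _)) ⟩
      Rₖ * Rₗ * (Aₖ * A′ₗ * (Bₖ * B′ₗ))
        ≈⟨ solve 6 (λ rk rl a a′ b b′ → rk :* rl :* (a :* a′ :* (b :* b′)) := a :* (b :* rk) :* (a′ :* (b′ :* rl)))
            refl Rₖ Rₗ Aₖ A′ₗ Bₖ B′ₗ ⟩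
      Aₖ * (Bₖ * Rₖ) * (A′ₗ * (B′ₗ * Rₗ))
        ≈⟨ sym (*-cong (value₁ k) (value₂ l)) ⟩
      value γ₁ k * value γ₂ l
        ≈⟨ cross-multiply (coeff≉0 k) (coeff*value-pair γ₁ k l k≢l kills₁) (coeff*value-pair γ₂ k l k≢l kills₂) ⟩
      value γ₂ k * value γ₁ l
        ≈⟨ *-cong (value₂ k) (value₁ l) ⟩
      A′ₖ * (B′ₖ * Rₖ) * (Aₗ * (Bₗ * Rₗ))
        ≈⟨ solve 6 (λ rk rl a a′ b b′ → a′ :* (b′ :* rk) :* (a :* (b :* rl)) := rk :* rl :* (a′ :* a :* (b′ :* b)))
            refl Rₖ Rₗ Aₗ A′ₖ Bₗ B′ₖ ⟩
      Rₖ * Rₗ * (A′ₖ * Aₗ * (B′ₖ * Bₗ))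
        ≈⟨ *-congˡ (sym (*-cong (σ.*-homo β₁ _ _) (σ.*-homo β₂ _ _))) ⟩
      Rₖ * Rₗ * (σ β₁ (D k j * D l i) * σ β₂ (D k i * D l j)) ∎)
      where
      open Complement k≢l
      placed = placing-others β₁≢β₂ i≢j i≢k i≢l j≢k j≢l
      slot₁ slot₂ : Fin (suc d₁) → Point
      slot₁ = proj₁ placed
      slot₂ = slot₁ ∘ transpose β₁ β₂
      slot₁-β₁ : slot₁ β₁ ≡ i
      slot₁-β₁ = proj₁ (proj₂ placed)
      slot₁-β₂ : slot₁ β₂ ≡ j
      slot₁-β₂ = proj₁ (proj₂ (proj₂ placed))
      slot₁-onto : ∀ y → y ≢ k → y ≢ l → ∃ λ w → slot₁ w ≡ y
      slot₁-onto = proj₂ (proj₂ (proj₂ (proj₂ (proj₂ placed))))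
      γ₁ γ₂ : Fin (suc d₁) → Vect n
      γ₁ = dualForm ∘ slot₁
      γ₂ = dualForm ∘ slot₂
      kills₁ : ∀ y → y ≢ k → y ≢ l → Kills γ₁ y
      kills₁ y y≢k y≢l = dualForms-kill slot₁ y (proj₁ (slot₁-onto y y≢k y≢l)) (proj₂ (slot₁-onto y y≢k y≢l))
      kills₂ : ∀ y → y ≢ k → y ≢ l → Kills γ₂ y
      kills₂ y y≢k y≢l = dualForms-kill slot₂ y (transpose β₂ β₁ w)
        (≡.trans (≡.cong slot₁ (transpose-inverse β₁ β₂ {w})) (proj₂ (slot₁-onto y y≢k y≢l)))
        where w = proj₁ (slot₁-onto y y≢k y≢l)
      rest : Point → Carrier
      rest = remaining slot₁ β₁ β₂
      value₁ : ∀ x → value γ₁ x ≈ σ β₁ (D x i) * (σ β₂ (D x j) * rest x)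
      value₁ x = trans (dualForms-value₂ slot₁ x β₁≢β₂)
        (*-cong (reflexive (≡.cong (λ y → σ β₁ (D x y)) slot₁-β₁))
                (*-congʳ (reflexive (≡.cong (λ y → σ β₂ (D x y)) slot₁-β₂))))
      value₂ : ∀ x → value γ₂ x ≈ σ β₁ (D x j) * (σ β₂ (D x i) * rest x)
      value₂ x = trans (dualForms-value₂ slot₂ x β₁≢β₂)
        (*-cong (reflexive (≡.cong (λ y → σ β₁ (D x y)) (≡.trans (≡.cong slot₁ (transpose-left β₁ β₂)) slot₁-β₂)))
                (*-cong (reflexive (≡.cong (λ y → σ β₂ (D x y)) (≡.trans (≡.cong slot₁ (transpose-right β₁ β₂)) slot₁-β₁)))
                        (remaining-transpose slot₁ β₁ β₂ x)))
      Rₖ≉0 = remaining≉0 slot₁ k β₁≢β₂ (proj₁ (proj₂ (proj₂ (proj₂ placed))))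
      Rₗ≉0 = remaining≉0 slot₁ l β₁≢β₂ (proj₁ (proj₂ (proj₂ (proj₂ (proj₂ placed)))))
      Rₖ = rest k
      Rₗ = rest l
      Aₖ = σ β₁ (D k i)
      Aₗ = σ β₁ (D l i)
      A′ₖ = σ β₁ (D k j)
      A′ₗ = σ β₁ (D l j)
      Bₖ = σ β₂ (D k j)
      Bₗ = σ β₂ (D l j)
      B′ₖ = σ β₂ (D k i)
      B′ₗ = σ β₂ (D l i)

    u : Point → Vect 2
    u x = pair2 (α x) (β x)

    U : Point → Fin (suc d₁) → Vect 2
    U x κ j = σ κ (u x j)

    det₂ : Vect 2 → Vect 2 → Carrier
    det₂ v w = det (v 0F) (v 1F) (w 0F) (w 1F)

    det₂-U : ∀ x y κ → det₂ (U x κ) (U y κ) ≈ σ κ (D x y)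
    det₂-U x y κ = sym (σ.det-homo κ (α x) (β x) (α y) (β y))

    det₂-U≉0 : ∀ {x y} κ → x ≢ y → det₂ (U x κ) (U y κ) ≉ 0#
    det₂-U≉0 {x} {y} κ x≢y = σ.≉0-homo κ (D≉0 x y x≢y) ∘ trans (sym (det₂-U x y κ))

    U≉0 : ∀ x κ → ¬ ((U x κ 0F ≈ 0#) × (U x κ 1F ≈ 0#))
    U≉0 x κ (U₀≈0 , U₁≈0) = coords≉0 x (σ.kernel κ _ U₀≈0 , σ.kernel κ _ U₁≈0)

    -- LineMeetsS with σ κ in place of frob q (h κ); the two agree definitionally for the Frobenius maps.
    MeetsS : Vect2d (suc d₁) → Vect2d (suc d₁) → Vect 2 → Set (c ⊔ ℓ)
    MeetsS X Y w = Σ Carrier λ A → Σ Carrier λ B → Σ (Fin (suc d₁) → Carrier) λ s →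
      ¬ ((A ≈ 0#) × (B ≈ 0#)) ×
      (∀ κ j → A * X κ j + B * Y κ j ≈ ∑ (suc d₁) (λ κ′ → s κ′ * ι κ′ (λ j′ → σ κ′ (w j′)) κ j))

    σD-antisym : ∀ κ x y → σ κ (D x y) ≈ - σ κ (D y x)
    σD-antisym κ x y = trans (σ.cong κ (D-antisym x y)) (σ.-‿homo κ _)

    module Transversal (X Y : Vect2d (suc d₁)) (X⊥Y : Indep₂-2d X Y) where
      coordA coordB : ∀ {w} → MeetsS X Y w → Carrier
      coordA m = proj₁ m
      coordB m = proj₁ (proj₂ m)

      scale : ∀ {w} → MeetsS X Y w → Fin (suc d₁) → Carrier
      scale m = proj₁ (proj₂ (proj₂ m))

      nondegenerate : ∀ {w} (m : MeetsS X Y w) → ¬ ((coordA m ≈ 0#) × (coordB m ≈ 0#))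
      nondegenerate m = proj₁ (proj₂ (proj₂ (proj₂ m)))

      block : ∀ {x} (m : MeetsS X Y (u x)) κ j → coordA m * X κ j + coordB m * Y κ j ≈ scale m κ * U x κ j
      block {x} m κ j = trans (proj₂ (proj₂ (proj₂ (proj₂ m))) κ j) (ι-sum (suc d₁) (scale m) (U x) κ j)

      meetsS-of-blocks : ∀ {x} A B s → ¬ ((A ≈ 0#) × (B ≈ 0#)) →
                         (∀ κ j → A * X κ j + B * Y κ j ≈ s κ * U x κ j) → MeetsS X Y (u x)
      meetsS-of-blocks {x} A B s AB≉0 blocks =
        A , B , s , AB≉0 , λ κ j → trans (blocks κ j) (sym (ι-sum (suc d₁) s (U x) κ j))

      meets-det≉0 : ∀ {x₁ x₂} → x₁ ≢ x₂ → (m₁ : MeetsS X Y (u x₁)) (m₂ : MeetsS X Y (u x₂)) →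
                    det (coordA m₁) (coordB m₁) (coordA m₂) (coordB m₂) ≉ 0#
      meets-det≉0 {x₁} {x₂} x₁≢x₂ m₁ m₂ det≈0 = nondegenerate m₂ (X⊥Y (coordA m₂) (coordB m₂) λ κ j →
        trans (block m₂ κ j) (trans (*-congʳ (scale₂≈0 κ)) (zeroˡ _)))
        where
        proportional = det≈0⇒proportional (nondegenerate m₁) det≈0
        t = proj₁ proportional
        scaled : ∀ κ j → scale m₂ κ * U x₂ κ j ≈ (t * scale m₁ κ) * U x₁ κ j
        scaled κ j = begin
          scale m₂ κ * U x₂ κ j
            ≈⟨ sym (block m₂ κ j) ⟩
          coordA m₂ * X κ j + coordB m₂ * Y κ j
            ≈⟨ +-cong (*-congʳ (proj₁ (proj₂ proportional))) (*-congʳ (proj₂ (proj₂ proportional))) ⟩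
          t * coordA m₁ * X κ j + t * coordB m₁ * Y κ j
            ≈⟨ solve 5 (λ t a x b y → t :* a :* x :+ t :* b :* y := t :* (a :* x :+ b :* y))
                refl t (coordA m₁) (X κ j) (coordB m₁) (Y κ j) ⟩
          t * (coordA m₁ * X κ j + coordB m₁ * Y κ j)
            ≈⟨ *-congˡ (block m₁ κ j) ⟩
          t * (scale m₁ κ * U x₁ κ j)
            ≈⟨ sym (*-assoc _ _ _) ⟩
          (t * scale m₁ κ) * U x₁ κ j ∎
        scale₂≈0 : ∀ κ → scale m₂ κ ≈ 0#
        scale₂≈0 κ = scale≈0-of-independent (det₂-U≉0 κ x₁≢x₂) (scaled κ 0F) (scaled κ 1F)

      module Fourth {i j k l : Point} (i≢j : i ≢ j) (i≢k : i ≢ k) (j≢k : j ≢ k) (l≢i : l ≢ i) (l≢j : l ≢ j) (l≢k : l ≢ k)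
                    (mᵢ : MeetsS X Y (u i)) (mⱼ : MeetsS X Y (u j)) (mₖ : MeetsS X Y (u k)) where
        Aᵢ Bᵢ Aⱼ Bⱼ Aₖ Bₖ Δ μ ν : Carrier
        Aᵢ = coordA mᵢ
        Bᵢ = coordB mᵢ
        Aⱼ = coordA mⱼ
        Bⱼ = coordB mⱼ
        Aₖ = coordA mₖ
        Bₖ = coordB mₖ
        Δ = det Aᵢ Bᵢ Aⱼ Bⱼ
        μ = det Aₖ Bₖ Aⱼ Bⱼ
        ν = det Aᵢ Bᵢ Aₖ Bₖ

        block-k : ∀ κ j′ → Δ * scale mₖ κ * U k κ j′ ≈ μ * scale mᵢ κ * U i κ j′ + ν * scale mⱼ κ * U j κ j′
        block-k κ j′ = begin
          Δ * scale mₖ κ * U k κ j′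
            ≈⟨ *-assoc _ _ _ ⟩
          Δ * (scale mₖ κ * U k κ j′)
            ≈⟨ *-congˡ (sym (block mₖ κ j′)) ⟩
          Δ * (Aₖ * X κ j′ + Bₖ * Y κ j′)
            ≈⟨ solve 5 (λ d a x b y → d :* (a :* x :+ b :* y) := (d :* a) :* x :+ (d :* b) :* y)
                refl Δ Aₖ (X κ j′) Bₖ (Y κ j′) ⟩
          (Δ * Aₖ) * X κ j′ + (Δ * Bₖ) * Y κ j′
            ≈⟨ +-cong (*-congʳ (proj₁ (cramer Aᵢ Bᵢ Aⱼ Bⱼ Aₖ Bₖ))) (*-congʳ (proj₂ (cramer Aᵢ Bᵢ Aⱼ Bⱼ Aₖ Bₖ))) ⟩
          (μ * Aᵢ + ν * Aⱼ) * X κ j′ + (μ * Bᵢ + ν * Bⱼ) * Y κ j′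
            ≈⟨ solve 8 (λ m n ai aj bi bj x y → (m :* ai :+ n :* aj) :* x :+ (m :* bi :+ n :* bj) :* y
                                                := m :* (ai :* x :+ bi :* y) :+ n :* (aj :* x :+ bj :* y))
                                                    refl μ ν Aᵢ Aⱼ Bᵢ Bⱼ (X κ j′) (Y κ j′) ⟩
          μ * (Aᵢ * X κ j′ + Bᵢ * Y κ j′) + ν * (Aⱼ * X κ j′ + Bⱼ * Y κ j′)
            ≈⟨ +-cong (*-congˡ (block mᵢ κ j′)) (*-congˡ (block mⱼ κ j′)) ⟩
          μ * (scale mᵢ κ * U i κ j′) + ν * (scale mⱼ κ * U j κ j′)
            ≈⟨ sym (+-cong (*-assoc _ _ _) (*-assoc _ _ _)) ⟩
          μ * scale mᵢ κ * U i κ j′ + ν * scale mⱼ κ * U j κ j′ ∎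

        h g : Carrier
        h = σ 0F (D k i * D l j)
        g = σ 0F (D k j * D l i)

        cross₀ : ∀ κ → g * σ κ (D k i * D l j) ≈ h * σ κ (D k j * D l i)
        cross₀ 0F      = *-comm g h
        cross₀ (suc κ) = cross (i≢j ∘ ≡.sym) j≢k (l≢j ∘ ≡.sym) i≢k (l≢i ∘ ≡.sym) (l≢k ∘ ≡.sym) (λ ())

        bracket : ∀ κ → h * det₂ (U k κ) (U j κ) * det₂ (U i κ) (U l κ) + g * det₂ (U i κ) (U k κ) * det₂ (U j κ) (U l κ) ≈ 0#
        bracket κ = begin
          h * det₂ (U k κ) (U j κ) * det₂ (U i κ) (U l κ) + g * det₂ (U i κ) (U k κ) * det₂ (U j κ) (U l κ)
            ≈⟨ +-cong (*-cong (*-congˡ (det₂-U k j κ)) (trans (det₂-U i l κ) (σD-antisym κ i l)))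
                      (*-cong (*-congˡ (trans (det₂-U i k κ) (σD-antisym κ i k))) (trans (det₂-U j l κ) (σD-antisym κ j l))) ⟩
          h * σ κ (D k j) * (- σ κ (D l i)) + g * (- σ κ (D k i)) * (- σ κ (D l j))
            ≈⟨ solve 6 (λ h g a b c d → h :* a :* (:- b) :+ g :* (:- c) :* (:- d) := g :* (c :* d) :- h :* (a :* b))
                refl h g _ _ _ _ ⟩
          g * (σ κ (D k i) * σ κ (D l j)) - h * (σ κ (D k j) * σ κ (D l i))
            ≈⟨ +-cong (*-congˡ (sym (σ.*-homo κ _ _))) (-‿cong (*-congˡ (sym (σ.*-homo κ _ _)))) ⟩
          g * σ κ (D k i * D l j) - h * σ κ (D k j * D l i)
            ≈⟨ x≈y⇒x-y≈0 (cross₀ κ) ⟩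
          0# ∎

        Z : Fin (suc d₁) → Vect 2
        Z κ j′ = h * (μ * scale mᵢ κ) * U i κ j′ + g * (ν * scale mⱼ κ) * U j κ j′

        det-Z-Uₗ : ∀ κ → det₂ (Z κ) (U l κ) ≈ 0#
        det-Z-Uₗ κ = x*y≈0⇒y≈0 (det₂-U≉0 κ i≢j) (begin
          det₂ (U i κ) (U j κ) * det₂ (Z κ) (U l κ)
            ≈⟨ det-combination (U i κ 0F) (U i κ 1F) (U j κ 0F) (U j κ 1F) (U k κ 0F) (U k κ 1F) (U l κ 0F) (U l κ 1F)
                               (μ * scale mᵢ κ) (ν * scale mⱼ κ) (Δ * scale mₖ κ) g h (block-k κ 0F) (block-k κ 1F) ⟩
          Δ * scale mₖ κ * (h * det₂ (U k κ) (U j κ) * det₂ (U i κ) (U l κ) + g * det₂ (U i κ) (U k κ) * det₂ (U j κ) (U l κ))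
            ≈⟨ trans (*-congˡ (bracket κ)) (zeroʳ _) ⟩
          0# ∎)

        Z∥Uₗ : ∀ κ → ∃ λ e → (Z κ 0F ≈ e * U l κ 0F) × (Z κ 1F ≈ e * U l κ 1F)
        Z∥Uₗ κ = det≈0⇒proportional (U≉0 l κ)
          (trans (det-antisym (U l κ 0F) (U l κ 1F) (Z κ 0F) (Z κ 1F)) (trans (-‿cong (det-Z-Uₗ κ)) -0#≈0#))

        Z≈eUₗ : ∀ κ j′ → Z κ j′ ≈ proj₁ (Z∥Uₗ κ) * U l κ j′
        Z≈eUₗ κ 0F = proj₁ (proj₂ (Z∥Uₗ κ))
        Z≈eUₗ κ 1F = proj₂ (proj₂ (Z∥Uₗ κ))

        A′ B′ : Carrier
        A′ = h * μ * Aᵢ + g * ν * Aⱼ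
        B′ = h * μ * Bᵢ + g * ν * Bⱼ

        A′B′≉0 : ¬ ((A′ ≈ 0#) × (B′ ≈ 0#))
        A′B′≉0 (A′≈0 , B′≈0) = *-nonzero (*-nonzero h≉0 μ≉0) Δ≉0 (begin
          h * μ * Δ
            ≈⟨ solve 6 (λ ai bi aj bj r t → r :* (ai :* bj :- bi :* aj) := (r :* ai :+ t :* aj) :* bj :- (r :* bi :+ t :* bj) :* aj)
                refl Aᵢ Bᵢ Aⱼ Bⱼ (h * μ) (g * ν) ⟩
          A′ * Bⱼ - B′ * Aⱼ
            ≈⟨ +-cong (trans (*-congʳ A′≈0) (zeroˡ _)) (-‿cong (trans (*-congʳ B′≈0) (zeroˡ _))) ⟩
          0# - 0#
            ≈⟨ -‿inverseʳ 0# ⟩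
          0# ∎)
          where
          h≉0 = σ.≉0-homo 0F (*-nonzero (D≉0 k i (i≢k ∘ ≡.sym)) (D≉0 l j l≢j))
          μ≉0 = meets-det≉0 (j≢k ∘ ≡.sym) mₖ mⱼ
          Δ≉0 = meets-det≉0 i≢j mᵢ mⱼ

        meets : MeetsS X Y (u l)
        meets = meetsS-of-blocks A′ B′ (proj₁ ∘ Z∥Uₗ) A′B′≉0 λ κ j′ → begin
          A′ * X κ j′ + B′ * Y κ j′
            ≈⟨ solve 8 (λ r t ai aj bi bj x y → (r :* ai :+ t :* aj) :* x :+ (r :* bi :+ t :* bj) :* y
                                                := r :* (ai :* x :+ bi :* y) :+ t :* (aj :* x :+ bj :* y))
                                                    refl (h * μ) (g * ν) Aᵢ Aⱼ Bᵢ Bⱼ (X κ j′) (Y κ j′) ⟩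
          h * μ * (Aᵢ * X κ j′ + Bᵢ * Y κ j′) + g * ν * (Aⱼ * X κ j′ + Bⱼ * Y κ j′)
            ≈⟨ +-cong (*-congˡ (block mᵢ κ j′)) (*-congˡ (block mⱼ κ j′)) ⟩
          h * μ * (scale mᵢ κ * U i κ j′) + g * ν * (scale mⱼ κ * U j κ j′)
            ≈⟨ solve 8 (λ h μ g ν sᵢ sⱼ uᵢ uⱼ → h :* μ :* (sᵢ :* uᵢ) :+ g :* ν :* (sⱼ :* uⱼ)
                          := h :* (μ :* sᵢ) :* uᵢ :+ g :* (ν :* sⱼ) :* uⱼ)
                 refl h μ g ν (scale mᵢ κ) (scale mⱼ κ) (U i κ j′) (U j κ j′) ⟩
          Z κ j′
            ≈⟨ Z≈eUₗ κ j′ ⟩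
          proj₁ (Z∥Uₗ κ) * U l κ j′ ∎

    threeImpliesAll : ∀ (X Y : Vect2d (suc d₁)) → Indep₂-2d X Y →
      ∀ (i j k : Point) → ¬ (i ≡ j) → ¬ (i ≡ k) → ¬ (j ≡ k) →
      MeetsS X Y (u i) → MeetsS X Y (u j) → MeetsS X Y (u k) → ∀ l → MeetsS X Y (u l)
    threeImpliesAll X Y X⊥Y i j k i≢j i≢k j≢k mᵢ mⱼ mₖ l with l Fin.≟ i | l Fin.≟ j | l Fin.≟ k
    ... | yes ≡.refl | _          | _          = mᵢ
    ... | no _       | yes ≡.refl | _          = mⱼ
    ... | no _       | no _       | yes ≡.refl = mₖ
    ... | no l≢i     | no l≢j     | no l≢k     = Transversal.Fourth.meets X Y X⊥Y i≢j i≢k j≢k l≢i l≢j l≢k mᵢ mⱼ mₖ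

mainTheorem4 : {c ℓ : Level} (F : CommutativeRing c ℓ) →
    let open CommutativeRing F in let open FieldDefs F in
    (p e q t n d : ℕ) → Prime p → 1 ≤ e → q ≡ p ^ e → 1 ≤ t → 2 ≤ n → 2 ≤ d →
    IsFiniteFieldOfOrder (q ^ t) →
    (h : Fin d → ℕ) → (∀ i → h i < t) → ∑ℕ d (λ i → q ^ h i) < q ^ t →
    (P : Fin (suc (suc d)) → Vect n) →
    (∀ i → NonZero (P i)) →
    (∀ i j → ¬ (i ≡ j) → ¬ SamePoint (P i) (P j)) →
    LinDepTensors d (suc (suc d)) (λ i → tensorImage q d h (P i)) →
    Σ (Vect n) λ a → Σ (Vect n) λ b →
      Indep₂ a b ×
      (∀ i → ∃ λ α → ∃ λ β → ∀ j → P i j ≈ α * a j + β * b j) ×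
      (∀ (α β : Fin (suc (suc d)) → Carrier) →
         (∀ i j → P i j ≈ α i * a j + β i * b j) →
         ThreeImpliesAll q d (suc (suc d)) h (λ i → pair2 (α i) (β i)))
mainTheorem4 F p e q t n d p-prime _ q≡pᵉ _ _ (s≤s (s≤s z≤n)) finite h _ _ P P≉0 distinct (coeff , coeff≢0 , dependent) =
  P a₀ , P b₀ , independent , collinear , λ α β P≈αa+βb →
    LineCoordinates.threeImpliesAll σ σ-hom coeff P dependent P≉0 distinct coeff≢0 (P a₀) (P b₀) independent α β P≈αa+βb
  where
  open FieldDefs F
  open RingLemmas F using (IsInjectiveHom)
  open FiniteField F finite
  σ : Fin d → CommutativeRing.Carrier F → CommutativeRing.Carrier F
  σ i = frob q (h i)
  σ-hom : ∀ i → IsInjectiveHom (σ i)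
  σ-hom i = ≡.subst (λ m → IsInjectiveHom (λ x → pow x m)) (≡.sym (power q≡pᵉ (h i)))
                    (frobenius {m = e ℕ.* t} p-prime (power q≡pᵉ t) (e ℕ.* h i))
    where
    power : ∀ {q} → q ≡ p ^ e → ∀ k → q ^ k ≡ p ^ (e ℕ.* k)
    power ≡.refl k = ℕ.^-*-assoc p e k
  open DependentImages F isField _≟_
  open Collinearity σ σ-hom coeff P dependent P≉0 distinct coeff≢0
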